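{- Let $k,m$ be integers with $k\ge 2$ and $1\le m\le k$, and let $G$ be a connected graph of order $n\ge \frac{13k}{2}+4m+7$ with minimum degree $\delta(G)\ge k+m$. If $$e(G)\ge \binom{n-k-1}{2}+k^2+2k+(k+1)m,$$ then $G$ is a fractional $(k,m)$-covered graph.
   Context: All graphs are finite, simple and undirected; $e(G)$ is the number of edges of $G$. For a function $h:E(G)\to[0,1]$, let $E_h=\{e\in E(G): h(e)>0\}$; if $a\le \sum_{e\ni u} h(e)\le b$ for every vertex $u$ (sum over edges incident with $u$), then $G[E_h]$ is a fractional $[a,b]$-factor of $G$ with indicator function $h$. A graph $G$ is a fractional $(k,m)$-covered graph if for every subgraph $H\subseteq G$ with $|E(H)|=m$ there exists a fractional $[k,k]$-factor of $G$ with indicator function $h$ such that $h(e)=1$ for every $e\in E(H)$. -}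

module Defs where

open import Data.Nat as ℕ using (ℕ; zero; suc; _<_)
open import Data.Fin using (Fin; toℕ)
import Data.Fin as F
open import Data.Bool using (Bool; true; false; if_then_else_)
open import Data.Rational as ℚ using (ℚ; 0ℚ; 1ℚ; _/_)
open import Data.Integer using (+_)
open import Relation.Binary.PropositionalEquality using (_≡_)
open import Relation.Nullary using (does)
open import Data.Product using (Σ)

record Graph (n : ℕ) : Set where
  field
    adj   : Fin n → Fin n → Bool
    sym   : ∀ u v → adj u v ≡ adj v u
    irrefl : ∀ u → adj u u ≡ false
open Graph public

sumℕ : ∀ {n} → (Fin n → ℕ) → ℕ
sumℕ {zero} f = 0
sumℕ {suc n} f = f F.zero ℕ.+ sumℕ (λ i → f (F.suc i))

sumℚ : ∀ {n} → (Fin n → ℚ) → ℚ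
sumℚ {zero} f = 0ℚ
sumℚ {suc n} f = f F.zero ℚ.+ sumℚ (λ i → f (F.suc i))

b2n : Bool → ℕ
b2n true = 1
b2n false = 0

degree : ∀ {n} → Graph n → Fin n → ℕ
degree G u = sumℕ (λ v → b2n (adj G u v))

pairCount : ∀ {n} → (Fin n → Fin n → Bool) → ℕ
pairCount R = sumℕ (λ u → sumℕ (λ v →
  if does (toℕ u ℕ.<? toℕ v) then b2n (R u v) else 0))

edgeCount : ∀ {n} → Graph n → ℕ
edgeCount G = pairCount (adj G)

minDegree≥ : ∀ {n} → Graph n → ℕ → Set
minDegree≥ G d = ∀ u → d ℕ.≤ degree G u

data Reach {n} (G : Graph n) : Fin n → Fin n → Set where
  here : ∀ {u} → Reach G u u
  step : ∀ {u v w} → adj G u v ≡ true → Reach G v w → Reach G u w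

Connected : ∀ {n} → Graph n → Set
Connected {n} G = ∀ (u v : Fin n) → Reach G u v

-- An edge set of a subgraph H ⊆ G: a symmetric Boolean relation contained in adj G.
-- (Isolated vertices of H are irrelevant for the covering condition, so H is
-- determined by its edge set.)
record EdgeSubset {n} (G : Graph n) : Set where
  field
    mem  : Fin n → Fin n → Bool
    msym : ∀ u v → mem u v ≡ mem v u
    sub  : ∀ u v → mem u v ≡ true → adj G u v ≡ true
open EdgeSubset public

-- A fractional [k,k]-factor of G with indicator function h : E(G) → [0,1],
-- h encoded as a symmetric function on vertex pairs vanishing off E(G).
record FractionalKFactor {n} (G : Graph n) (k : ℕ) : Set where
  field
    h        : Fin n → Fin n → ℚ
    hsym     : ∀ u v → h u v ≡ h v u
    hoff     : ∀ u v → adj G u v ≡ false → h u v ≡ 0ℚ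
    hlow     : ∀ u v → 0ℚ ℚ.≤ h u v
    hhigh    : ∀ u v → h u v ℚ.≤ 1ℚ
    hdeg     : ∀ u → sumℚ (λ v → h u v) ≡ (+ k) / 1
open FractionalKFactor public

FractionalCovered : ∀ {n} → Graph n → ℕ → ℕ → Set
FractionalCovered G k m =
  ∀ (H : EdgeSubset G) → pairCount (mem H) ≡ m →
    Σ (FractionalKFactor G k) (λ F → ∀ u v → mem H u v ≡ true → h F u v ≡ 1ℚ)

module Submission where

-- Fix H ⊆ G with m edges and put a(u) = k − d_H(u). A fractional k-factor equal to 1 on E(H)
-- is h = (2·1_H + x + xᵀ)/2 for any 0/1 matrix x supported on E(G) − E(H) whose row and column
-- sums are all a. By max-flow/min-cut such an x exists unless a cover (R, Y) is deficient:
-- a(R) + a(Y) + #(entries missed by R and Y) < Σ a. This is proved by induction on the number of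
-- entries, the covers found after deleting an entry being combined by submodularity. For a
-- symmetric matrix a deficient cover yields disjoint S, T with
-- k|S| + d_{G−S}(T) < k|T| + Σ_{x∈S} d_H(x). Since d_H ≤ m, Σ_S d_H ≤ 2m and δ(G) ≥ k + m,
-- this forces |T| > k and |S| < |T| + m. Writing |T| = k + 1 + j, the edges at T together with a
-- complete graph on V − T then number fewer than the assumed lower bound on e(G): for large j
-- because |S| ≤ n − |T|, otherwise because n ≥ 13k/2 + 4m + 7.

open import Defs hiding (sym)
open import Data.Nat using (ℕ; zero; suc; pred; _+_; _*_; _∸_; _≤_; _<_; _≤ᵇ_; _≤?_; _<?_; z≤n; s≤s)
open import Data.Nat.Properties hiding (_≟_)
open import Data.Nat.Tactic.RingSolver using (solve-∀)
open import Data.Nat.Combinatorics using (_C_; nCk+nC[k+1]≡[n+1]C[k+1]; nC1≡n)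
open import Data.Fin using (Fin; zero; suc; toℕ; _≟_)
open import Data.Fin.Properties using (any?; toℕ-injective)
open import Data.Bool using (Bool; true; false; not; _∧_; _∨_; if_then_else_)
import Data.Bool as Bool
open import Data.Bool.Properties using (T-∧; ∧-comm; ∧-identityʳ; ∧-zeroʳ; ∨-zeroʳ; ¬-not)
open import Data.Product using (Σ; _×_; _,_; proj₁; proj₂)
open import Data.Sum as Sum using (_⊎_; inj₁; inj₂; [_,_]′)
open import Data.Empty using (⊥; ⊥-elim)
open import Data.Rational as ℚ using (ℚ; 0ℚ; 1ℚ; _/_)
open import Function using (id; _∘_)
open import Function.Bundles using (Equivalence)
open import Relation.Binary.Definitions using (tri<; tri≈; tri>)
open import Relation.Binary.PropositionalEquality
open import Relation.Nullary using (does; yes; no)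
open import Relation.Nullary.Decidable using (dec-true; dec-false)
import Algebra.Properties.CommutativeMonoid.Sum as CommutativeMonoidSum

-- Finite sums

module ℕSum = CommutativeMonoidSum +-0-commutativeMonoid

sumℕ≡sum : ∀ {N} (f : Fin N → ℕ) → sumℕ f ≡ ℕSum.sum f
sumℕ≡sum {zero}  f = refl
sumℕ≡sum {suc N} f = cong (f zero +_) (sumℕ≡sum (f ∘ suc))

sumℕ-cong : ∀ {N} {f g : Fin N → ℕ} → (∀ i → f i ≡ g i) → sumℕ f ≡ sumℕ g
sumℕ-cong {zero}  f≗g = refl
sumℕ-cong {suc N} f≗g = cong₂ _+_ (f≗g zero) (sumℕ-cong (f≗g ∘ suc))

sumℕ-mono : ∀ {N} {f g : Fin N → ℕ} → (∀ i → f i ≤ g i) → sumℕ f ≤ sumℕ g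
sumℕ-mono {zero}  f≤g = z≤n
sumℕ-mono {suc N} f≤g = +-mono-≤ (f≤g zero) (sumℕ-mono (f≤g ∘ suc))

sumℕ-+ : ∀ {N} (f g : Fin N → ℕ) → sumℕ (λ i → f i + g i) ≡ sumℕ f + sumℕ g
sumℕ-+ f g = begin
  sumℕ (λ i → f i + g i)      ≡⟨ sumℕ≡sum (λ i → f i + g i) ⟩
  ℕSum.sum (λ i → f i + g i)  ≡⟨ ℕSum.∑-distrib-+ f g ⟩
  ℕSum.sum f + ℕSum.sum g     ≡⟨ cong₂ _+_ (sumℕ≡sum f) (sumℕ≡sum g) ⟨
  sumℕ f + sumℕ g             ∎
  where open ≡-Reasoning

sumℕ-comm : ∀ {M N} (f : Fin M → Fin N → ℕ) →
            sumℕ (λ i → sumℕ (f i)) ≡ sumℕ (λ j → sumℕ (λ i → f i j))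
sumℕ-comm f = begin
  sumℕ (λ i → sumℕ (f i))                   ≡⟨ sumℕ-cong (λ i → sumℕ≡sum (f i)) ⟩
  sumℕ (λ i → ℕSum.sum (f i))               ≡⟨ sumℕ≡sum (λ i → ℕSum.sum (f i)) ⟩
  ℕSum.sum (λ i → ℕSum.sum (f i))           ≡⟨ ℕSum.∑-comm f ⟩
  ℕSum.sum (λ j → ℕSum.sum (λ i → f i j))   ≡⟨ sumℕ≡sum (λ j → ℕSum.sum (λ i → f i j)) ⟨
  sumℕ (λ j → ℕSum.sum (λ i → f i j))       ≡⟨ sumℕ-cong (λ j → sumℕ≡sum (λ i → f i j)) ⟨
  sumℕ (λ j → sumℕ (λ i → f i j))           ∎
  where open ≡-Reasoning

sumℕ-const : ∀ {N} (c : ℕ) → sumℕ {N} (λ _ → c) ≡ N * c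
sumℕ-const {zero}  c = refl
sumℕ-const {suc N} c = cong (c +_) (sumℕ-const {N} c)

sumℕ-zero : ∀ {N} → sumℕ {N} (λ _ → 0) ≡ 0
sumℕ-zero {N} = trans (sumℕ-const {N} 0) (*-zeroʳ N)

sumℕ-*ˡ : ∀ {N} (c : ℕ) (f : Fin N → ℕ) → sumℕ (λ i → c * f i) ≡ c * sumℕ f
sumℕ-*ˡ {zero}  c f = sym (*-zeroʳ c)
sumℕ-*ˡ {suc N} c f =
  trans (cong (c * f zero +_) (sumℕ-*ˡ c (f ∘ suc))) (sym (*-distribˡ-+ c (f zero) _))

term≤sumℕ : ∀ {N} (f : Fin N → ℕ) (i : Fin N) → f i ≤ sumℕ f
term≤sumℕ f zero    = m≤m+n _ _
term≤sumℕ f (suc i) = ≤-trans (term≤sumℕ (f ∘ suc) i) (m≤n+m _ _)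

sumℕ≡0⇒≡0 : ∀ {N} (f : Fin N → ℕ) → sumℕ f ≡ 0 → ∀ i → f i ≡ 0
sumℕ≡0⇒≡0 f Σf≡0 i = n≤0⇒n≡0 (subst (f i ≤_) Σf≡0 (term≤sumℕ f i))

b2n≤1 : ∀ b → b2n b ≤ 1
b2n≤1 true  = s≤s z≤n
b2n≤1 false = z≤n

∨-≡-trueˡ : ∀ {x} y → x ≡ true → x ∨ y ≡ true
∨-≡-trueˡ y refl = refl

∧-true : ∀ {x y} → x ∧ y ≡ true → x ≡ true × y ≡ true
∧-true {true} {true} _ = refl , refl

if-b2n-comm : ∀ p q → (if p then b2n q else 0) ≡ (if q then b2n p else 0)
if-b2n-comm true  true  = refl
if-b2n-comm true  false = refl
if-b2n-comm false true  = refl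
if-b2n-comm false false = refl

x+y<s+s⇒x<s⊎y<s : ∀ {x y s} → x + y < s + s → x < s ⊎ y < s
x+y<s+s⇒x<s⊎y<s {x} {y} {s} x+y<2s with x <? s | y <? s
... | yes x<s | _       = inj₁ x<s
... | no _    | yes y<s = inj₂ y<s
... | no x≮s  | no y≮s  = ⊥-elim (<⇒≱ x+y<2s (+-mono-≤ (≮⇒≥ x≮s) (≮⇒≥ y≮s)))

every : (Bool → Bool) → Bool
every p = p true ∧ p false

every-elim : ∀ p → Bool.T (every p) → ∀ b → Bool.T (p b)
every-elim p t true  = proj₁ (Equivalence.to T-∧ t)
every-elim p t false = proj₂ (Equivalence.to T-∧ t)

decide-≤⁴ : ∀ {f g : Bool → Bool → Bool → Bool → ℕ} →
  Bool.T (every λ x → every λ y → every λ z → every λ w → f x y z w ≤ᵇ g x y z w) →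
  ∀ x y z w → f x y z w ≤ g x y z w
decide-≤⁴ {f} {g} t x y z w = ≤ᵇ⇒≤ _ _
  (every-elim (φ x y z) (every-elim (every ∘ φ x y) (every-elim (λ y → every (every ∘ φ x y))
    (every-elim (λ x → every λ y → every (every ∘ φ x y)) t x) y) z) w)
  where
  φ : Bool → Bool → Bool → Bool → Bool
  φ x y z w = f x y z w ≤ᵇ g x y z w

infixr 7 _∩_
infixr 6 _∪_

_∩_ _∪_ : ∀ {N} → (Fin N → Bool) → (Fin N → Bool) → Fin N → Bool
(P ∩ Q) i = P i ∧ Q i
(P ∪ Q) i = P i ∨ Q i

∁ : ∀ {N} → (Fin N → Bool) → Fin N → Bool
∁ P i = not (P i)

sumOn : ∀ {N} → (Fin N → Bool) → (Fin N → ℕ) → ℕ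
sumOn P f = sumℕ (λ i → if P i then f i else 0)

size : ∀ {N} → (Fin N → Bool) → ℕ
size P = sumℕ (λ i → b2n (P i))

δ : ∀ {N} → Fin N → Fin N → Bool
δ ℓ i = does (i ≟ ℓ)

δ-refl : ∀ {N} (ℓ : Fin N) → δ ℓ ℓ ≡ true
δ-refl zero    = refl
δ-refl (suc ℓ) = δ-refl ℓ

δ-true : ∀ {N} {ℓ i : Fin N} → δ ℓ i ≡ true → i ≡ ℓ
δ-true {ℓ = zero}  {zero}  _ = refl
δ-true {ℓ = suc ℓ} {suc i} e = cong suc (δ-true e)

sumOn-δ : ∀ {N} (ℓ : Fin N) (f : Fin N → ℕ) → sumOn (δ ℓ) f ≡ f ℓ
sumOn-δ {suc N} zero f = trans (cong (f zero +_) (sumℕ-zero {N})) (+-identityʳ _)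
sumOn-δ (suc ℓ) f = sumOn-δ ℓ (f ∘ suc)

size-δ : ∀ {N} (ℓ : Fin N) → size (δ ℓ) ≡ 1
size-δ ℓ = trans (sumℕ-cong (λ i → b2n-if (δ ℓ i))) (sumOn-δ ℓ (λ _ → 1))
  where
  b2n-if : ∀ x → b2n x ≡ (if x then 1 else 0)
  b2n-if true  = refl
  b2n-if false = refl

sumOn-congˡ : ∀ {N} {P Q : Fin N → Bool} (f : Fin N → ℕ) → (∀ i → P i ≡ Q i) → sumOn P f ≡ sumOn Q f
sumOn-congˡ f P≗Q = sumℕ-cong (λ i → cong (if_then f i else 0) (P≗Q i))

sumOn-+ : ∀ {N} (P : Fin N → Bool) (f g : Fin N → ℕ) →
          sumOn P (λ i → f i + g i) ≡ sumOn P f + sumOn P g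
sumOn-+ P f g = trans (sumℕ-cong (λ i → if-+ (P i)))
  (sumℕ-+ (λ i → if P i then f i else 0) (λ i → if P i then g i else 0))
  where
  if-+ : ∀ {x y} p → (if p then x + y else 0) ≡ (if p then x else 0) + (if p then y else 0)
  if-+ true  = refl
  if-+ false = refl

sumOn-mono : ∀ {N} (P : Fin N → Bool) {f g : Fin N → ℕ} → (∀ i → f i ≤ g i) → sumOn P f ≤ sumOn P g
sumOn-mono P f≤g = sumℕ-mono (λ i → if-mono (P i) (f≤g i))
  where
  if-mono : ∀ {x y} p → x ≤ y → (if p then x else 0) ≤ (if p then y else 0)
  if-mono true  x≤y = x≤y
  if-mono false _   = z≤n

sumOn-const : ∀ {N} (P : Fin N → Bool) (c : ℕ) → sumOn P (λ _ → c) ≡ c * size P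
sumOn-const P c = trans (sumℕ-cong (λ i → if-const (P i))) (sumℕ-*ˡ c (λ i → b2n (P i)))
  where
  if-const : ∀ p → (if p then c else 0) ≡ c * b2n p
  if-const true  = sym (*-identityʳ c)
  if-const false = sym (*-zeroʳ c)

sumOn≤sumℕ : ∀ {N} (P : Fin N → Bool) (f : Fin N → ℕ) → sumOn P f ≤ sumℕ f
sumOn≤sumℕ P f = sumℕ-mono (λ i → if≤ (P i))
  where
  if≤ : ∀ {x} p → (if p then x else 0) ≤ x
  if≤ true  = ≤-refl
  if≤ false = z≤n

sumOn-split : ∀ {N} (P Q : Fin N → Bool) (f : Fin N → ℕ) →
              sumOn P f ≡ sumOn (P ∩ Q) f + sumOn (P ∩ ∁ Q) f
sumOn-split P Q f = trans (sumℕ-cong (λ i → cell (P i) (Q i)))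
  (sumℕ-+ (λ i → if P i ∧ Q i then f i else 0) (λ i → if P i ∧ not (Q i) then f i else 0))
  where
  cell : ∀ {x} p q → (if p then x else 0) ≡ (if p ∧ q then x else 0) + (if p ∧ not q then x else 0)
  cell true  true  = sym (+-identityʳ _)
  cell true  false = refl
  cell false q     = refl

sumOn-∩∪ : ∀ {N} (P Q : Fin N → Bool) (f : Fin N → ℕ) →
           sumOn (P ∩ Q) f + sumOn (P ∪ Q) f ≡ sumOn P f + sumOn Q f
sumOn-∩∪ P Q f = begin
  sumOn (P ∩ Q) f + sumOn (P ∪ Q) f
    ≡⟨ sumℕ-+ (λ i → if P i ∧ Q i then f i else 0) (λ i → if P i ∨ Q i then f i else 0) ⟨
  sumℕ (λ i → (if P i ∧ Q i then f i else 0) + (if P i ∨ Q i then f i else 0))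
    ≡⟨ sumℕ-cong (λ i → cell (P i) (Q i)) ⟩
  sumℕ (λ i → (if P i then f i else 0) + (if Q i then f i else 0))
    ≡⟨ sumℕ-+ (λ i → if P i then f i else 0) (λ i → if Q i then f i else 0) ⟩
  sumOn P f + sumOn Q f ∎
  where
  open ≡-Reasoning
  cell : ∀ {x} p q → (if p ∧ q then x else 0) + (if p ∨ q then x else 0)
                     ≡ (if p then x else 0) + (if q then x else 0)
  cell {x} true q   = +-comm (if q then x else 0) x
  cell false true  = refl
  cell false false = refl

sumOn-∪ : ∀ {N} (P Q : Fin N → Bool) (f : Fin N → ℕ) →
          sumOn (P ∪ Q) f ≤ sumOn P f + sumOn Q f
sumOn-∪ P Q f = ≤-trans (m≤n+m _ _) (≤-reflexive (sumOn-∩∪ P Q f))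

lower : ∀ {N} → (Fin N → ℕ) → Fin N → Fin N → ℕ
lower a ℓ i = if δ ℓ i then pred (a i) else a i

lower-split : ∀ {N} {a : Fin N → ℕ} {ℓ a₀} → a ℓ ≡ suc a₀ → ∀ i → a i ≡ b2n (δ ℓ i) + lower a ℓ i
lower-split {a = a} {ℓ} aℓ i with δ ℓ i in e
... | true with refl ← δ-true {ℓ = ℓ} {i} e rewrite aℓ = refl
... | false = refl

sumOn-lower : ∀ {N} (P : Fin N → Bool) {a : Fin N → ℕ} {ℓ a₀} → a ℓ ≡ suc a₀ →
              sumOn P a ≡ b2n (P ℓ) + sumOn P (lower a ℓ)
sumOn-lower P {a} {ℓ} aℓ = begin
  sumOn P a                                               ≡⟨ sumℕ-cong (λ i → cong (if P i then_else 0) (lower-split aℓ i)) ⟩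
  sumOn P (λ i → b2n (δ ℓ i) + lower a ℓ i)               ≡⟨ sumOn-+ P (λ i → b2n (δ ℓ i)) (lower a ℓ) ⟩
  sumOn P (λ i → b2n (δ ℓ i)) + sumOn P (lower a ℓ)       ≡⟨ cong (_+ sumOn P (lower a ℓ)) picked ⟩
  b2n (P ℓ) + sumOn P (lower a ℓ)                         ∎
  where
  open ≡-Reasoning
  picked : sumOn P (λ i → b2n (δ ℓ i)) ≡ b2n (P ℓ)
  picked = trans (sumℕ-cong (λ i → if-b2n-comm (P i) (δ ℓ i))) (sumOn-δ ℓ (λ i → b2n (P i)))

sumℕ-lower : ∀ {N} (a : Fin N → ℕ) ℓ {a₀} → a ℓ ≡ suc a₀ → sumℕ a ≡ suc (sumℕ (lower a ℓ))
sumℕ-lower a ℓ = sumOn-lower (λ _ → true) {a} {ℓ}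

-- Transportation problems

Matrix : ℕ → ℕ → Set
Matrix M N = Fin M → Fin N → Bool

module _ {M N : ℕ} where

  rowSum : Matrix M N → Fin M → ℕ
  rowSum x i = size (x i)

  colSum : Matrix M N → Fin N → ℕ
  colSum x j = size (λ i → x i j)

  sumOnEntries : Matrix M N → (Fin M → Fin N → ℕ) → ℕ
  sumOnEntries c w = sumℕ (λ i → sumOn (c i) (w i))

  entryCount : Matrix M N → ℕ
  entryCount c = sumOnEntries c (λ _ _ → 1)

  unit : Fin M → Fin N → Matrix M N
  unit ℓ r i j = δ ℓ i ∧ δ r j

  remove insert : Fin M → Fin N → Matrix M N → Matrix M N
  remove ℓ r c i j = if unit ℓ r i j then false else c i j
  insert ℓ r c i j = if unit ℓ r i j then true else c i j

  unit-true : ∀ {ℓ r i j} → unit ℓ r i j ≡ true → i ≡ ℓ × j ≡ r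
  unit-true {ℓ} {r} {i} {j} e with ∧-true {δ ℓ i} e
  ... | eℓ , er = δ-true eℓ , δ-true er

  unit-refl : ∀ ℓ r → unit ℓ r ℓ r ≡ true
  unit-refl ℓ r rewrite δ-refl ℓ | δ-refl r = refl

  remove-⊆ : ∀ {ℓ r c} i j → remove ℓ r c i j ≡ true → c i j ≡ true
  remove-⊆ {ℓ} {r} i j e with unit ℓ r i j
  ... | false = e

  remove-at : ∀ ℓ r c → remove ℓ r c ℓ r ≡ false
  remove-at ℓ r c rewrite unit-refl ℓ r = refl

  sumOnEntries-+ : ∀ c (v w : Fin M → Fin N → ℕ) →
    sumOnEntries c (λ i j → v i j + w i j) ≡ sumOnEntries c v + sumOnEntries c w
  sumOnEntries-+ c v w =
    trans (sumℕ-cong (λ i → sumOn-+ (c i) (v i) (w i)))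
          (sumℕ-+ (λ i → sumOn (c i) (v i)) (λ i → sumOn (c i) (w i)))

  sumOnEntries-mono : ∀ c {v w : Fin M → Fin N → ℕ} → (∀ i j → v i j ≤ w i j) →
    sumOnEntries c v ≤ sumOnEntries c w
  sumOnEntries-mono c v≤w = sumℕ-mono (λ i → sumOn-mono (c i) (v≤w i))

  sumOnEntries-unit : ∀ ℓ r w → sumOnEntries (unit ℓ r) w ≡ w ℓ r
  sumOnEntries-unit ℓ r w = begin
    sumℕ (λ i → sumOn (unit ℓ r i) (w i))                ≡⟨ sumℕ-cong (λ i → row i (δ ℓ i)) ⟩
    sumOn (δ ℓ) (λ i → sumOn (δ r) (w i))                ≡⟨ sumOn-δ ℓ _ ⟩
    sumOn (δ r) (w ℓ)                                    ≡⟨ sumOn-δ r (w ℓ) ⟩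
    w ℓ r                                                ∎
    where
    open ≡-Reasoning
    row : ∀ i d → sumOn (λ j → d ∧ δ r j) (w i) ≡ (if d then sumOn (δ r) (w i) else 0)
    row i true  = refl
    row i false = sumℕ-zero {N}

  sumOnEntries-remove : ∀ {ℓ r c} w → c ℓ r ≡ true →
    sumOnEntries c w ≡ w ℓ r + sumOnEntries (remove ℓ r c) w
  sumOnEntries-remove {ℓ} {r} {c} w cℓr = begin
    sumOnEntries c w
      ≡⟨ sumℕ-cong (λ i → sumℕ-cong (λ j → cell i j (unit ℓ r i j) refl)) ⟩
    sumℕ (λ i → sumℕ (λ j → (if unit ℓ r i j then w i j else 0) + (if remove ℓ r c i j then w i j else 0)))
      ≡⟨ sumℕ-cong (λ i → sumℕ-+ (λ j → if unit ℓ r i j then w i j else 0) (λ j → if remove ℓ r c i j then w i j else 0)) ⟩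
    sumℕ (λ i → sumOn (unit ℓ r i) (w i) + sumOn (remove ℓ r c i) (w i))
      ≡⟨ sumℕ-+ (λ i → sumOn (unit ℓ r i) (w i)) (λ i → sumOn (remove ℓ r c i) (w i)) ⟩
    sumOnEntries (unit ℓ r) w + sumOnEntries (remove ℓ r c) w
      ≡⟨ cong (_+ sumOnEntries (remove ℓ r c) w) (sumOnEntries-unit ℓ r w) ⟩
    w ℓ r + sumOnEntries (remove ℓ r c) w ∎
    where
    open ≡-Reasoning
    cell : ∀ i j u → unit ℓ r i j ≡ u →
      (if c i j then w i j else 0) ≡ (if u then w i j else 0) + (if remove ℓ r c i j then w i j else 0)
    cell i j true  e with refl , refl ← unit-true {ℓ} {r} {i} {j} e rewrite cℓr | e = sym (+-identityʳ _)
    cell i j false e rewrite e = refl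

  record Transport (c : Matrix M N) (a : Fin M → ℕ) (b : Fin N → ℕ) : Set where
    field
      flow    : Matrix M N
      flow⊆c  : ∀ i j → flow i j ≡ true → c i j ≡ true
      rowSums : ∀ i → rowSum flow i ≡ a i
      colSums : ∀ j → colSum flow j ≡ b j

  uncovered : Matrix M N → (Fin M → Bool) → (Fin N → Bool) → ℕ
  uncovered c R Y = sumOnEntries c (λ i j → b2n (not (R i) ∧ not (Y j)))

  -- The capacity of the cut in the network source → rows (capacities a) → columns (capacity 1
  -- per entry of c) → sink (capacities b) whose sink side holds the rows R and whose source side
  -- holds the columns Y.
  coverCost : Matrix M N → (Fin M → ℕ) → (Fin N → ℕ) → (Fin M → Bool) → (Fin N → Bool) → ℕ
  coverCost c a b R Y = sumOn R a + sumOn Y b + uncovered c R Y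

  record DeficientCover (c : Matrix M N) (a : Fin M → ℕ) (b : Fin N → ℕ) : Set where
    field
      rows      : Fin M → Bool
      cols      : Fin N → Bool
      deficient : coverCost c a b rows cols < sumℕ a

  uncovered-submodular-cell : ∀ r₁ r₂ y₁ y₂ →
    b2n (not (r₁ ∧ r₂) ∧ not (y₁ ∨ y₂)) + b2n (not (r₁ ∨ r₂) ∧ not (y₁ ∧ y₂))
      ≤ b2n (not r₁ ∧ not y₁) + b2n (not r₂ ∧ not y₂)
  uncovered-submodular-cell = decide-≤⁴ _

  coverCost-submodular : ∀ c a b R₁ Y₁ R₂ Y₂ →
    coverCost c a b (R₁ ∩ R₂) (Y₁ ∪ Y₂) + coverCost c a b (R₁ ∪ R₂) (Y₁ ∩ Y₂)
      ≤ coverCost c a b R₁ Y₁ + coverCost c a b R₂ Y₂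
  coverCost-submodular c a b R₁ Y₁ R₂ Y₂ = begin
    coverCost c a b (R₁ ∩ R₂) (Y₁ ∪ Y₂) + coverCost c a b (R₁ ∪ R₂) (Y₁ ∩ Y₂)
      ≡⟨ regroup (sumOn (R₁ ∩ R₂) a) (sumOn (Y₁ ∪ Y₂) b) _ (sumOn (R₁ ∪ R₂) a) (sumOn (Y₁ ∩ Y₂) b) _ ⟩
    (sumOn (R₁ ∩ R₂) a + sumOn (R₁ ∪ R₂) a) + (sumOn (Y₁ ∪ Y₂) b + sumOn (Y₁ ∩ Y₂) b)
      + (uncovered c (R₁ ∩ R₂) (Y₁ ∪ Y₂) + uncovered c (R₁ ∪ R₂) (Y₁ ∩ Y₂))
      ≤⟨ +-mono-≤ (≤-reflexive (cong₂ _+_ (sumOn-∩∪ R₁ R₂ a) (trans (+-comm (sumOn (Y₁ ∪ Y₂) b) _) (sumOn-∩∪ Y₁ Y₂ b)))) uncovered-submodular ⟩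
    (sumOn R₁ a + sumOn R₂ a) + (sumOn Y₁ b + sumOn Y₂ b) + (uncovered c R₁ Y₁ + uncovered c R₂ Y₂)
      ≡⟨ regroup (sumOn R₁ a) (sumOn Y₁ b) _ (sumOn R₂ a) (sumOn Y₂ b) _ ⟨
    coverCost c a b R₁ Y₁ + coverCost c a b R₂ Y₂ ∎
    where
    open ≤-Reasoning
    regroup : ∀ a₁ b₁ u₁ a₂ b₂ u₂ → a₁ + b₁ + u₁ + (a₂ + b₂ + u₂) ≡ (a₁ + a₂) + (b₁ + b₂) + (u₁ + u₂)
    regroup = solve-∀
    uncovered-submodular : uncovered c (R₁ ∩ R₂) (Y₁ ∪ Y₂) + uncovered c (R₁ ∪ R₂) (Y₁ ∩ Y₂)
                           ≤ uncovered c R₁ Y₁ + uncovered c R₂ Y₂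
    uncovered-submodular = subst₂ _≤_ (sumOnEntries-+ c _ _) (sumOnEntries-+ c _ _)
      (sumOnEntries-mono c (λ i j → uncovered-submodular-cell (R₁ i) (R₂ i) (Y₁ j) (Y₂ j)))

  coverCost-remove : ∀ {ℓ r c} a b R Y → c ℓ r ≡ true →
    coverCost c a b R Y ≡ b2n (not (R ℓ) ∧ not (Y r)) + coverCost (remove ℓ r c) a b R Y
  coverCost-remove {ℓ} {r} {c} a b R Y cℓr =
    trans (cong (sumOn R a + sumOn Y b +_) (sumOnEntries-remove w cℓr))
          (rotate (sumOn R a) (sumOn Y b) (w ℓ r) (uncovered (remove ℓ r c) R Y))
    where
    w : Fin M → Fin N → ℕ
    w i j = b2n (not (R i) ∧ not (Y j))
    rotate : ∀ x y d u → x + y + (d + u) ≡ d + (x + y + u)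
    rotate = solve-∀

  coverCost-lower : ∀ {c a b ℓ r a₀ b₀} R Y → a ℓ ≡ suc a₀ → b r ≡ suc b₀ →
    coverCost c a b R Y ≡ b2n (R ℓ) + b2n (Y r) + coverCost c (lower a ℓ) (lower b r) R Y
  coverCost-lower {c} {a} {b} {ℓ} {r} R Y aℓ br =
    trans (cong₂ (λ x y → x + y + uncovered c R Y) (sumOn-lower R aℓ) (sumOn-lower Y br))
          (regroup (b2n (R ℓ)) (sumOn R (lower a ℓ)) (b2n (Y r)) (sumOn Y (lower b r)) (uncovered c R Y))
    where
    regroup : ∀ p x q y u → p + x + (q + y) + u ≡ p + q + (x + y + u)
    regroup = solve-∀

  uncovered-antitone : ∀ c {R R′ Y Y′} → (∀ i → R i ≡ true → R′ i ≡ true) → (∀ j → Y j ≡ true → Y′ j ≡ true) →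
    uncovered c R′ Y′ ≤ uncovered c R Y
  uncovered-antitone c R⊆R′ Y⊆Y′ = sumOnEntries-mono c (λ i j → cell (R⊆R′ i) (Y⊆Y′ j))
    where
    cell : ∀ {r r′ y y′} → (r ≡ true → r′ ≡ true) → (y ≡ true → y′ ≡ true) →
           b2n (not r′ ∧ not y′) ≤ b2n (not r ∧ not y)
    cell {r′ = true} _ _ = z≤n
    cell {true} {false} r→r′ _ with () ← r→r′ refl
    cell {false} {false} {y′ = true} _ _ = z≤n
    cell {false} {false} {true} {false} _ y→y′ with () ← y→y′ refl
    cell {false} {false} {false} {false} _ _ = ≤-refl

  coverCost-remove-covered : ∀ {ℓ r c} a b R Y → c ℓ r ≡ true → R ℓ ≡ true ⊎ Y r ≡ true →
    coverCost c a b R Y ≡ coverCost (remove ℓ r c) a b R Y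
  coverCost-remove-covered {ℓ} {r} {c} a b R Y cℓr covered =
    trans (coverCost-remove a b R Y cℓr) (cong (_+ coverCost (remove ℓ r c) a b R Y) (uncounted covered))
    where
    uncounted : R ℓ ≡ true ⊎ Y r ≡ true → b2n (not (R ℓ) ∧ not (Y r)) ≡ 0
    uncounted (inj₁ e) rewrite e = refl
    uncounted (inj₂ e) rewrite e = cong b2n (∧-zeroʳ (not (R ℓ)))

  sumOn-∪δ-zero : ∀ {K} (P : Fin K → Bool) {a : Fin K → ℕ} {ℓ} → a ℓ ≡ 0 → sumOn (P ∪ δ ℓ) a ≤ sumOn P a
  sumOn-∪δ-zero P {a} {ℓ} aℓ≡0 = ≤-trans (sumOn-∪ P (δ ℓ) a)
    (≤-reflexive (trans (cong (sumOn P a +_) (trans (sumOn-δ ℓ a) aℓ≡0)) (+-identityʳ _)))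

  cover-zero-row : ∀ {ℓ r c a b} → c ℓ r ≡ true → a ℓ ≡ 0 →
    DeficientCover (remove ℓ r c) a b → DeficientCover c a b
  cover-zero-row {ℓ} {r} {c} {a} {b} cℓr aℓ≡0 d =
    record { rows = R ∪ δ ℓ ; cols = Y ; deficient = ≤-<-trans cost≤ deficient }
    where
    open DeficientCover d renaming (rows to R; cols to Y)
    ℓ∈R∪δℓ : (R ∪ δ ℓ) ℓ ≡ true
    ℓ∈R∪δℓ rewrite δ-refl ℓ = ∨-zeroʳ (R ℓ)
    cost≤ : coverCost c a b (R ∪ δ ℓ) Y ≤ coverCost (remove ℓ r c) a b R Y
    cost≤ = ≤-trans (≤-reflexive (coverCost-remove-covered a b (R ∪ δ ℓ) Y cℓr (inj₁ ℓ∈R∪δℓ)))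
      (+-mono-≤ (+-monoˡ-≤ (sumOn Y b) (sumOn-∪δ-zero R aℓ≡0))
                (uncovered-antitone (remove ℓ r c) {R} {R ∪ δ ℓ} {Y} {Y} (λ i → ∨-≡-trueˡ (δ ℓ i)) (λ _ → id)))

  cover-zero-col : ∀ {ℓ r c a b} → c ℓ r ≡ true → b r ≡ 0 →
    DeficientCover (remove ℓ r c) a b → DeficientCover c a b
  cover-zero-col {ℓ} {r} {c} {a} {b} cℓr br≡0 d =
    record { rows = R ; cols = Y ∪ δ r ; deficient = ≤-<-trans cost≤ deficient }
    where
    open DeficientCover d renaming (rows to R; cols to Y)
    r∈Y∪δr : (Y ∪ δ r) r ≡ true
    r∈Y∪δr rewrite δ-refl r = ∨-zeroʳ (Y r)
    cost≤ : coverCost c a b R (Y ∪ δ r) ≤ coverCost (remove ℓ r c) a b R Y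
    cost≤ = ≤-trans (≤-reflexive (coverCost-remove-covered a b R (Y ∪ δ r) cℓr (inj₂ r∈Y∪δr)))
      (+-mono-≤ (+-monoʳ-≤ (sumOn R a) (sumOn-∪δ-zero Y br≡0))
                (uncovered-antitone (remove ℓ r c) {R} {R} {Y} {Y ∪ δ r} (λ _ → id) (λ j → ∨-≡-trueˡ (δ r j))))

  transport-remove : ∀ {ℓ r c a b} → Transport (remove ℓ r c) a b → Transport c a b
  transport-remove {ℓ} {r} {c} t = record
    { flow = flow ; flow⊆c = λ i j e → remove-⊆ {ℓ} {r} {c} i j (flow⊆c i j e) ; rowSums = rowSums ; colSums = colSums }
    where open Transport t

  size-unit-row : ∀ ℓ r i → size (unit ℓ r i) ≡ b2n (δ ℓ i)
  size-unit-row ℓ r i with δ ℓ i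
  ... | true  = size-δ r
  ... | false = sumℕ-zero {N}

  size-unit-col : ∀ ℓ r j → size (λ i → unit ℓ r i j) ≡ b2n (δ r j)
  size-unit-col ℓ r j with δ r j
  ... | true  = trans (sumℕ-cong (λ i → cong b2n (∧-identityʳ (δ ℓ i)))) (size-δ ℓ)
  ... | false = trans (sumℕ-cong (λ i → cong b2n (∧-zeroʳ (δ ℓ i)))) (sumℕ-zero {M})

  transport-insert : ∀ {ℓ r c a b a₀ b₀} → c ℓ r ≡ true → a ℓ ≡ suc a₀ → b r ≡ suc b₀ →
    Transport (remove ℓ r c) (lower a ℓ) (lower b r) → Transport c a b
  transport-insert {ℓ} {r} {c} {a} {b} cℓr aℓ br t = record
    { flow = insert ℓ r x ; flow⊆c = inserted⊆c ; rowSums = rows ; colSums = cols }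
    where
    open Transport t renaming (flow to x)
    xℓr : x ℓ r ≡ false
    xℓr with x ℓ r in e
    ... | false = refl
    ... | true with () ← trans (sym (flow⊆c ℓ r e)) (remove-at ℓ r c)
    inserted⊆c : ∀ i j → insert ℓ r x i j ≡ true → c i j ≡ true
    inserted⊆c i j e with unit ℓ r i j in u
    ... | true with refl , refl ← unit-true {ℓ} {r} {i} {j} u = cℓr
    ... | false = remove-⊆ {ℓ} {r} {c} i j (flow⊆c i j e)
    cell : ∀ i j → b2n (insert ℓ r x i j) ≡ b2n (unit ℓ r i j) + b2n (x i j)
    cell i j with unit ℓ r i j in u
    ... | true with refl , refl ← unit-true {ℓ} {r} {i} {j} u rewrite xℓr = refl
    ... | false = refl
    rows : ∀ i → rowSum (insert ℓ r x) i ≡ a i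
    rows i = begin
      rowSum (insert ℓ r x) i              ≡⟨ sumℕ-cong (cell i) ⟩
      sumℕ (λ j → b2n (unit ℓ r i j) + b2n (x i j))
                                           ≡⟨ sumℕ-+ (λ j → b2n (unit ℓ r i j)) (λ j → b2n (x i j)) ⟩
      size (unit ℓ r i) + rowSum x i       ≡⟨ cong₂ _+_ (size-unit-row ℓ r i) (rowSums i) ⟩
      b2n (δ ℓ i) + lower a ℓ i            ≡⟨ lower-split aℓ i ⟨
      a i                                  ∎
      where open ≡-Reasoning
    cols : ∀ j → colSum (insert ℓ r x) j ≡ b j
    cols j = begin
      colSum (insert ℓ r x) j              ≡⟨ sumℕ-cong (λ i → cell i j) ⟩
      sumℕ (λ i → b2n (unit ℓ r i j) + b2n (x i j))
                                           ≡⟨ sumℕ-+ (λ i → b2n (unit ℓ r i j)) (λ i → b2n (x i j)) ⟩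
      size (λ i → unit ℓ r i j) + colSum x j
                                           ≡⟨ cong₂ _+_ (size-unit-col ℓ r j) (colSums j) ⟩
      b2n (δ r j) + lower b r j            ≡⟨ lower-split br j ⟨
      b j                                  ∎
      where open ≡-Reasoning

  uncross-corner-cell : ∀ r₁ r₂ y₁ y₂ →
    b2n (not (r₁ ∧ r₂) ∧ not (y₁ ∨ y₂)) + b2n (not (r₁ ∨ r₂) ∧ not (y₁ ∧ y₂)) + (b2n r₂ + b2n y₂) ≤ 2
  uncross-corner-cell = decide-≤⁴ _

  cover-uncross : ∀ {ℓ r c a b a₀ b₀} → c ℓ r ≡ true → a ℓ ≡ suc a₀ → b r ≡ suc b₀ →
    DeficientCover (remove ℓ r c) a b → DeficientCover (remove ℓ r c) (lower a ℓ) (lower b r) →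
    DeficientCover c a b
  cover-uncross {ℓ} {r} {c} {a} {b} cℓr aℓ br d₁ d₂ = pick (x+y<s+s⇒x<s⊎y<s both)
    where
    open DeficientCover d₁ renaming (rows to R₁; cols to Y₁; deficient to small₁)
    open DeficientCover d₂ renaming (rows to R₂; cols to Y₂; deficient to small₂)
    cost cost₋ cost₋₋ : (Fin M → Bool) → (Fin N → Bool) → ℕ
    cost   = coverCost c a b
    cost₋  = coverCost (remove ℓ r c) a b
    cost₋₋ = coverCost (remove ℓ r c) (lower a ℓ) (lower b r)
    k₁ k₂ d : ℕ
    k₁ = b2n (not (R₁ ℓ ∧ R₂ ℓ) ∧ not (Y₁ r ∨ Y₂ r))
    k₂ = b2n (not (R₁ ℓ ∨ R₂ ℓ) ∧ not (Y₁ r ∧ Y₂ r))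
    d  = b2n (R₂ ℓ) + b2n (Y₂ r)
    A : ℕ
    A = sumℕ (lower a ℓ)
    Σa : sumℕ a ≡ suc A
    Σa = sumℕ-lower a ℓ aℓ
    room : cost₋ R₁ Y₁ + cost₋₋ R₂ Y₂ < A + A
    room = +-mono-≤-< (≤-pred (subst (cost₋ R₁ Y₁ <_) Σa small₁)) small₂
    both : cost (R₁ ∩ R₂) (Y₁ ∪ Y₂) + cost (R₁ ∪ R₂) (Y₁ ∩ Y₂) < sumℕ a + sumℕ a
    both = begin-strict
      cost (R₁ ∩ R₂) (Y₁ ∪ Y₂) + cost (R₁ ∪ R₂) (Y₁ ∩ Y₂)
        ≡⟨ cong₂ _+_ (coverCost-remove a b (R₁ ∩ R₂) (Y₁ ∪ Y₂) cℓr) (coverCost-remove a b (R₁ ∪ R₂) (Y₁ ∩ Y₂) cℓr) ⟩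
      (k₁ + cost₋ (R₁ ∩ R₂) (Y₁ ∪ Y₂)) + (k₂ + cost₋ (R₁ ∪ R₂) (Y₁ ∩ Y₂))
        ≡⟨ +-+-interchange k₁ _ k₂ _ ⟩
      (k₁ + k₂) + (cost₋ (R₁ ∩ R₂) (Y₁ ∪ Y₂) + cost₋ (R₁ ∪ R₂) (Y₁ ∩ Y₂))
        ≤⟨ +-monoʳ-≤ (k₁ + k₂) (coverCost-submodular (remove ℓ r c) a b R₁ Y₁ R₂ Y₂) ⟩
      (k₁ + k₂) + (cost₋ R₁ Y₁ + cost₋ R₂ Y₂)
        ≡⟨ cong (λ z → (k₁ + k₂) + (cost₋ R₁ Y₁ + z)) (coverCost-lower R₂ Y₂ aℓ br) ⟩
      (k₁ + k₂) + (cost₋ R₁ Y₁ + (d + cost₋₋ R₂ Y₂))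
        ≡⟨ regroup (k₁ + k₂) (cost₋ R₁ Y₁) d (cost₋₋ R₂ Y₂) ⟩
      (k₁ + k₂ + d) + (cost₋ R₁ Y₁ + cost₋₋ R₂ Y₂)
        ≤⟨ +-monoˡ-≤ _ (uncross-corner-cell (R₁ ℓ) (R₂ ℓ) (Y₁ r) (Y₂ r)) ⟩
      2 + (cost₋ R₁ Y₁ + cost₋₋ R₂ Y₂)
        <⟨ s≤s (subst (2 + (cost₋ R₁ Y₁ + cost₋₋ R₂ Y₂) ≤_) (sym (+-suc A A)) (s≤s room)) ⟩
      suc A + suc A
        ≡⟨ cong₂ _+_ Σa Σa ⟨
      sumℕ a + sumℕ a ∎
      where
      open ≤-Reasoning
      +-+-interchange : ∀ p x q y → (p + x) + (q + y) ≡ (p + q) + (x + y)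
      +-+-interchange = solve-∀
      regroup : ∀ k u e v → k + (u + (e + v)) ≡ k + e + (u + v)
      regroup = solve-∀
    pick : cost (R₁ ∩ R₂) (Y₁ ∪ Y₂) < sumℕ a ⊎ cost (R₁ ∪ R₂) (Y₁ ∩ Y₂) < sumℕ a → DeficientCover c a b
    pick (inj₁ small) = record { rows = R₁ ∩ R₂ ; cols = Y₁ ∪ Y₂ ; deficient = small }
    pick (inj₂ small) = record { rows = R₁ ∪ R₂ ; cols = Y₁ ∩ Y₂ ; deficient = small }

  transport-or-deficientCover-empty : ∀ {c a b} → (∀ i j → c i j ≡ false) → sumℕ a ≡ sumℕ b →
    Transport c a b ⊎ DeficientCover c a b
  transport-or-deficientCover-empty {c} {a} {b} empty Σa≡Σb = byTotal (sumℕ a) refl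
    where
    emptyRow : ∀ i → rowSum c i ≡ 0
    emptyRow i = trans (sumℕ-cong (λ j → cong b2n (empty i j))) (sumℕ-zero {N})
    emptyCol : ∀ j → colSum c j ≡ 0
    emptyCol j = trans (sumℕ-cong (λ i → cong b2n (empty i j))) (sumℕ-zero {M})
    free : coverCost c a b (λ _ → false) (λ _ → false) ≡ 0
    free = cong₂ _+_ (cong₂ _+_ (sumℕ-zero {M}) (sumℕ-zero {N}))
      (trans (sumℕ-cong (λ i → trans (sumℕ-cong (λ j → cong (if_then 1 else 0) (empty i j))) (sumℕ-zero {N})))
             (sumℕ-zero {M}))
    byTotal : ∀ s → sumℕ a ≡ s → Transport c a b ⊎ DeficientCover c a b
    byTotal zero Σa≡0 = inj₁ record
      { flow = c ; flow⊆c = λ _ _ e → e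
      ; rowSums = λ i → trans (emptyRow i) (sym (sumℕ≡0⇒≡0 a Σa≡0 i))
      ; colSums = λ j → trans (emptyCol j) (sym (sumℕ≡0⇒≡0 b (trans (sym Σa≡Σb) Σa≡0) j)) }
    byTotal (suc _) Σa≡suc = inj₂ record
      { rows = λ _ → false ; cols = λ _ → false
      ; deficient = subst (_< sumℕ a) (sym free) (subst (0 <_) (sym Σa≡suc) (s≤s z≤n)) }

  transport-or-deficientCover : ∀ c a b → sumℕ a ≡ sumℕ b → Transport c a b ⊎ DeficientCover c a b
  transport-or-deficientCover c a b = go (suc (entryCount c)) c ≤-refl
    where
    go : ∀ fuel c {a b} → entryCount c < fuel → sumℕ a ≡ sumℕ b → Transport c a b ⊎ DeficientCover c a b
    go (suc fuel) c {a} {b} count<fuel Σa≡Σb with any? (λ i → any? (λ j → c i j Bool.≟ true))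
    ... | no noEntry = transport-or-deficientCover-empty (λ i j → ¬-not (λ e → noEntry (i , j , e))) Σa≡Σb
    ... | yes (ℓ , r , cℓr) = split (go fuel (remove ℓ r c) count< Σa≡Σb) (a ℓ) refl (b r) refl
      where
      count< : entryCount (remove ℓ r c) < fuel
      count< = ≤-pred (subst (_< suc fuel) (sumOnEntries-remove (λ _ _ → 1) cℓr) count<fuel)
      split : Transport (remove ℓ r c) a b ⊎ DeficientCover (remove ℓ r c) a b →
              ∀ x → a ℓ ≡ x → ∀ y → b r ≡ y → Transport c a b ⊎ DeficientCover c a b
      split (inj₁ t)  _       _  _       _  = inj₁ (transport-remove t)
      split (inj₂ d)  zero    aℓ _       _  = inj₂ (cover-zero-row cℓr aℓ d)
      split (inj₂ d)  (suc _) _  zero    br = inj₂ (cover-zero-col cℓr br d)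
      split (inj₂ d₁) (suc _) aℓ (suc _) br
        with go fuel (remove ℓ r c) count< (suc-injective (trans (sym (sumℕ-lower a ℓ aℓ)) (trans Σa≡Σb (sumℕ-lower b r br))))
      ... | inj₁ t  = inj₁ (transport-insert cℓr aℓ br t)
      ... | inj₂ d₂ = inj₂ (cover-uncross cℓr aℓ br d₁ d₂)

-- Symmetric matrices

edgesBetween : ∀ {M N} → Matrix M N → (Fin M → Bool) → (Fin N → Bool) → ℕ
edgesBetween c P Q = sumOn P (λ i → sumOn Q (λ j → b2n (c i j)))

edgesBetween≡sumOnEntries : ∀ {M N} (c : Matrix M N) P Q →
  edgesBetween c P Q ≡ sumOnEntries c (λ i j → b2n (P i ∧ Q j))
edgesBetween≡sumOnEntries {N = N} c P Q = sumℕ-cong (λ i → row (P i) i)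
  where
  row : ∀ p i → (if p then sumOn Q (λ j → b2n (c i j)) else 0) ≡ sumOn (c i) (λ j → b2n (p ∧ Q j))
  row true  i = sumℕ-cong (λ j → if-b2n-comm (Q j) (c i j))
  row false i = sym (trans (sumℕ-cong (λ j → zero-if (c i j))) (sumℕ-zero {N}))
    where
    zero-if : ∀ x → (if x then 0 else 0) ≡ 0
    zero-if true  = refl
    zero-if false = refl

edgesBetween-+ : ∀ {M N} {c c₁ c₂ : Matrix M N} → (∀ i j → b2n (c i j) ≡ b2n (c₁ i j) + b2n (c₂ i j)) →
  ∀ P Q → edgesBetween c P Q ≡ edgesBetween c₁ P Q + edgesBetween c₂ P Q
edgesBetween-+ {c = c} {c₁} {c₂} split P Q = begin
  edgesBetween c P Q
    ≡⟨ sumℕ-cong (λ i → cong (if P i then_else 0) (trans (sumℕ-cong (λ j → cong (if Q j then_else 0) (split i j)))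
                                                       (sumOn-+ Q (λ j → b2n (c₁ i j)) (λ j → b2n (c₂ i j))))) ⟩
  sumOn P (λ i → sumOn Q (λ j → b2n (c₁ i j)) + sumOn Q (λ j → b2n (c₂ i j)))
    ≡⟨ sumOn-+ P _ _ ⟩
  edgesBetween c₁ P Q + edgesBetween c₂ P Q ∎
  where open ≡-Reasoning

edgesBetween≤sumOn-rowSum : ∀ {M N} (c : Matrix M N) P Q → edgesBetween c P Q ≤ sumOn P (rowSum c)
edgesBetween≤sumOn-rowSum c P Q = sumOn-mono P (λ i → sumOn≤sumℕ Q (λ j → b2n (c i j)))

Symmetric : ∀ {n} → Matrix n n → Set
Symmetric c = ∀ i j → c i j ≡ c j i

sumOnEntries-transpose : ∀ {n} {c : Matrix n n} → Symmetric c → ∀ w →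
  sumOnEntries c w ≡ sumOnEntries c (λ i j → w j i)
sumOnEntries-transpose {c = c} c-sym w =
  trans (sumℕ-comm (λ i j → if c i j then w i j else 0))
        (sumℕ-cong (λ j → sumℕ-cong (λ i → cong (if_then w i j else 0) (c-sym i j))))

edgesBetween-comm : ∀ {n} {c : Matrix n n} → Symmetric c → ∀ P Q → edgesBetween c P Q ≡ edgesBetween c Q P
edgesBetween-comm {c = c} c-sym P Q = begin
  edgesBetween c P Q                                 ≡⟨ edgesBetween≡sumOnEntries c P Q ⟩
  sumOnEntries c (λ i j → b2n (P i ∧ Q j))           ≡⟨ sumOnEntries-transpose c-sym _ ⟩
  sumOnEntries c (λ i j → b2n (P j ∧ Q i))           ≡⟨ sumℕ-cong (λ i → sumℕ-cong (λ j →
                                                          cong (λ z → if c i j then b2n z else 0) (∧-comm (P j) (Q i)))) ⟩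
  sumOnEntries c (λ i j → b2n (Q i ∧ P j))           ≡⟨ edgesBetween≡sumOnEntries c Q P ⟨
  edgesBetween c Q P                                 ∎
  where open ≡-Reasoning

record DeficientPair {n} (c : Matrix n n) (a : Fin n → ℕ) : Set where
  field
    S T       : Fin n → Bool
    S∩T≡∅     : ∀ i → S i ≡ true → T i ≡ false
    deficient : edgesBetween c T (∁ S) + sumOn S a < sumOn T a

edgesBetween≤uncovered-cell : ∀ rᵢ yᵢ rⱼ yⱼ →
  b2n ((not rᵢ ∧ not yᵢ) ∧ not yⱼ) + b2n ((not rⱼ ∧ not yⱼ) ∧ (yᵢ ∧ not rᵢ)) ≤ b2n (not rᵢ ∧ not yⱼ)
edgesBetween≤uncovered-cell = decide-≤⁴ _

edgesBetween≤uncovered : ∀ {n} {c : Matrix n n} → Symmetric c → ∀ R Y →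
  edgesBetween c (∁ R ∩ ∁ Y) (∁ (Y ∩ R)) ≤ uncovered c R Y
edgesBetween≤uncovered {n} {c} c-sym R Y = begin
  edgesBetween c T (∁ (Y ∩ R))
    ≡⟨ edgesBetween≡sumOnEntries c T (∁ (Y ∩ R)) ⟩
  sumOnEntries c (λ i j → b2n (T i ∧ not (Y j ∧ R j)))
    ≡⟨ trans (sumℕ-cong (λ i → sumℕ-cong (λ j → cong (if c i j then_else 0) (split (T i) (Y j) (R j)))))
             (sumOnEntries-+ c (λ i j → b2n (T i ∧ not (Y j))) (λ i j → b2n (T i ∧ (Y j ∧ not (R j))))) ⟩
  sumOnEntries c (λ i j → b2n (T i ∧ not (Y j))) + sumOnEntries c (λ i j → b2n (T i ∧ (Y j ∧ not (R j))))
    ≡⟨ cong (sumOnEntries c (λ i j → b2n (T i ∧ not (Y j))) +_) (sumOnEntries-transpose c-sym _) ⟩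
  sumOnEntries c (λ i j → b2n (T i ∧ not (Y j))) + sumOnEntries c (λ i j → b2n (T j ∧ (Y i ∧ not (R i))))
    ≡⟨ sumOnEntries-+ c _ _ ⟨
  sumOnEntries c (λ i j → b2n (T i ∧ not (Y j)) + b2n (T j ∧ (Y i ∧ not (R i))))
    ≤⟨ sumOnEntries-mono c (λ i j → edgesBetween≤uncovered-cell (R i) (Y i) (R j) (Y j)) ⟩
  uncovered c R Y ∎
  where
  open ≤-Reasoning
  T : Fin n → Bool
  T = ∁ R ∩ ∁ Y
  split : ∀ t y r → b2n (t ∧ not (y ∧ r)) ≡ b2n (t ∧ not y) + b2n (t ∧ (y ∧ not r))
  split false y     r     = refl
  split true  false r     = refl
  split true  true  false = refl
  split true  true  true  = refl

deficientCover⇒deficientPair : ∀ {n} {c : Matrix n n} {a} → Symmetric c →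
  DeficientCover c a a → DeficientPair c a
deficientCover⇒deficientPair {n} {c} {a} c-sym d = record
  { S = S ; T = T ; S∩T≡∅ = S∩T≡∅
  ; deficient = ≤-<-trans (+-monoˡ-≤ (sumOn S a) (edgesBetween≤uncovered c-sym R Y))
                  (+-cancelˡ-< M _ _ (+-cancelˡ-< (sumOn R a) _ _ key)) }
  where
  open DeficientCover d renaming (rows to R; cols to Y)
  S T : Fin n → Bool
  S = Y ∩ R
  T = ∁ R ∩ ∁ Y
  M : ℕ
  M = sumOn (∁ R ∩ Y) a
  S∩T≡∅ : ∀ i → S i ≡ true → T i ≡ false
  S∩T≡∅ i e with Y i | R i
  S∩T≡∅ i e | true | true = refl
  key : sumOn R a + (M + (uncovered c R Y + sumOn S a)) < sumOn R a + (M + sumOn T a)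
  key = begin-strict
    sumOn R a + (M + (uncovered c R Y + sumOn S a))
      ≡⟨ regroup (sumOn R a) M (uncovered c R Y) (sumOn S a) ⟩
    sumOn R a + (sumOn S a + M) + uncovered c R Y
      ≡⟨ cong (λ y → sumOn R a + (sumOn S a + y) + uncovered c R Y) (sumOn-congˡ a (λ i → ∧-comm (Y i) (not (R i)))) ⟨
    sumOn R a + (sumOn S a + sumOn (Y ∩ ∁ R) a) + uncovered c R Y
      ≡⟨ cong (λ y → sumOn R a + y + uncovered c R Y) (sumOn-split Y R a) ⟨
    coverCost c a a R Y
      <⟨ deficient ⟩
    sumℕ a
      ≡⟨ sumOn-split (λ _ → true) R a ⟩
    sumOn R a + sumOn (∁ R) a
      ≡⟨ cong (sumOn R a +_) (sumOn-split (∁ R) Y a) ⟩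
    sumOn R a + (M + sumOn T a) ∎
    where
    open ≤-Reasoning
    regroup : ∀ r m u s → r + (m + (u + s)) ≡ r + (s + m) + u
    regroup = solve-∀

symmetricTransport-or-deficientPair : ∀ {n} {c : Matrix n n} → Symmetric c → ∀ a →
  Transport c a a ⊎ DeficientPair c a
symmetricTransport-or-deficientPair {c = c} c-sym a =
  Sum.map₂ (deficientCover⇒deficientPair c-sym) (transport-or-deficientCover c a a refl)

Irreflexive : ∀ {n} → Matrix n n → Set
Irreflexive c = ∀ i → c i i ≡ false

aboveDiagonal : ∀ {n} → Matrix n n → Fin n → Fin n → ℕ
aboveDiagonal c u v = if does (toℕ u <? toℕ v) then b2n (c u v) else 0

entry≡above+below : ∀ {n} {c : Matrix n n} → Symmetric c → Irreflexive c →
  ∀ u v → b2n (c u v) ≡ aboveDiagonal c u v + aboveDiagonal c v u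
entry≡above+below {c = c} c-sym c-irr u v with <-cmp (toℕ u) (toℕ v)
... | tri< u<v _ _
  rewrite dec-true (toℕ u <? toℕ v) u<v | dec-false (toℕ v <? toℕ u) (<-asym u<v) = sym (+-identityʳ _)
... | tri> _ _ v<u
  rewrite dec-false (toℕ u <? toℕ v) (<-asym v<u) | dec-true (toℕ v <? toℕ u) v<u = cong b2n (c-sym u v)
... | tri≈ _ u≡v _
  rewrite toℕ-injective u≡v | dec-false (toℕ v <? toℕ v) (<-irrefl refl) = cong b2n (c-irr v)

handshake : ∀ {n} {c : Matrix n n} → Symmetric c → Irreflexive c → sumℕ (rowSum c) ≡ 2 * pairCount c
handshake {c = c} c-sym c-irr = begin
  sumℕ (rowSum c)
    ≡⟨ sumℕ-cong (λ u → trans (sumℕ-cong (entry≡above+below c-sym c-irr u)) (sumℕ-+ (aboveDiagonal c u) (λ v → aboveDiagonal c v u))) ⟩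
  sumℕ (λ u → sumℕ (aboveDiagonal c u) + sumℕ (λ v → aboveDiagonal c v u))
    ≡⟨ sumℕ-+ (λ u → sumℕ (aboveDiagonal c u)) (λ u → sumℕ (λ v → aboveDiagonal c v u)) ⟩
  pairCount c + sumℕ (λ u → sumℕ (λ v → aboveDiagonal c v u))
    ≡⟨ cong (pairCount c +_) (sumℕ-comm (aboveDiagonal c)) ⟨
  pairCount c + pairCount c
    ≡⟨ cong (pairCount c +_) (+-identityʳ (pairCount c)) ⟨
  2 * pairCount c ∎
  where open ≡-Reasoning

row+column≤total : ∀ {n} (F : Fin n → Fin n → ℕ) u → F u u ≡ 0 →
  sumℕ (F u) + sumℕ (λ i → F i u) ≤ sumℕ (λ i → sumℕ (F i))
row+column≤total F u Fuu≡0 = begin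
  sumℕ (F u) + sumℕ (λ i → F i u)      ≡⟨ merged ⟨
  sumℕ (λ i → if δ u i then sumℕ (F u) else F i u)
                                       ≤⟨ sumℕ-mono part≤row ⟩
  sumℕ (λ i → sumℕ (F i))              ∎
  where
  open ≤-Reasoning
  merged : sumℕ (λ i → if δ u i then sumℕ (F u) else F i u) ≡ sumℕ (F u) + sumℕ (λ i → F i u)
  merged = trans (sumℕ-cong cell)
    (trans (sumℕ-+ (λ i → if δ u i then sumℕ (F u) else 0) (λ i → F i u))
           (cong (_+ sumℕ (λ i → F i u)) (sumOn-δ u (λ _ → sumℕ (F u)))))
    where
    cell : ∀ i → (if δ u i then sumℕ (F u) else F i u) ≡ (if δ u i then sumℕ (F u) else 0) + F i u
    cell i with δ u i in e
    ... | true with refl ← δ-true {ℓ = u} {i} e rewrite Fuu≡0 = sym (+-identityʳ _)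
    ... | false = refl
  part≤row : ∀ i → (if δ u i then sumℕ (F u) else F i u) ≤ sumℕ (F i)
  part≤row i with δ u i in e
  ... | true with refl ← δ-true {ℓ = u} {i} e = ≤-refl
  ... | false = term≤sumℕ (F i) u

rowSum≤pairCount : ∀ {n} {c : Matrix n n} → Symmetric c → Irreflexive c → ∀ u → rowSum c u ≤ pairCount c
rowSum≤pairCount {c = c} c-sym c-irr u = begin
  rowSum c u                                   ≡⟨ sumℕ-cong (entry≡above+below c-sym c-irr u) ⟩
  sumℕ (λ v → aboveDiagonal c u v + aboveDiagonal c v u)       ≡⟨ sumℕ-+ (aboveDiagonal c u) (λ v → aboveDiagonal c v u) ⟩
  sumℕ (aboveDiagonal c u) + sumℕ (λ v → aboveDiagonal c v u)  ≤⟨ row+column≤total (aboveDiagonal c) u aboveDiagonal-refl ⟩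
  pairCount c                                  ∎
  where
  open ≤-Reasoning
  aboveDiagonal-refl : aboveDiagonal c u u ≡ 0
  aboveDiagonal-refl rewrite dec-false (toℕ u <? toℕ u) (<-irrefl refl) = refl

sumOn-b2n≤size : ∀ {N} (P Q : Fin N → Bool) → sumOn P (λ i → b2n (Q i)) ≤ size P
sumOn-b2n≤size P Q = sumℕ-mono (λ i → cell (P i) (Q i))
  where
  cell : ∀ p q → (if p then b2n q else 0) ≤ b2n p
  cell true  true  = ≤-refl
  cell true  false = z≤n
  cell false _     = z≤n

size-∁+size : ∀ {N} (P : Fin N → Bool) → size (∁ P) + size P ≡ N
size-∁+size {N} P = trans (sym (sumℕ-+ (λ i → b2n (not (P i))) (λ i → b2n (P i))))
                         (trans (sumℕ-cong (λ i → cell (P i))) (trans (sumℕ-const {N} 1) (*-identityʳ N)))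
  where
  cell : ∀ p → b2n (not p) + b2n p ≡ 1
  cell true  = refl
  cell false = refl

size-mono : ∀ {N} {P Q : Fin N → Bool} → (∀ i → P i ≡ true → Q i ≡ true) → size P ≤ size Q
size-mono {P = P} {Q} P⊆Q = sumℕ-mono (λ i → cell (P⊆Q i))
  where
  cell : ∀ {p q} → (p ≡ true → q ≡ true) → b2n p ≤ b2n q
  cell {false}        _   = z≤n
  cell {true} {true}  _   = ≤-refl
  cell {true} {false} p→q with () ← p→q refl

sumOn-row≤size∸1 : ∀ {n} {c : Matrix n n} → Irreflexive c → ∀ P u → P u ≡ true →
  sumOn P (λ v → b2n (c u v)) ≤ size P ∸ 1
sumOn-row≤size∸1 {c = c} c-irr P u u∈P = begin
  sumOn P (λ v → b2n (c u v))                        ≡⟨ m+n∸n≡m _ 1 ⟨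
  sumOn P (λ v → b2n (c u v)) + 1 ∸ 1                ≡⟨ cong (λ z → sumOn P (λ v → b2n (c u v)) + z ∸ 1) (size-δ u) ⟨
  sumOn P (λ v → b2n (c u v)) + size (δ u) ∸ 1       ≡⟨ cong (_∸ 1) (sumℕ-+ _ (λ v → b2n (δ u v))) ⟨
  sumℕ (λ v → (if P v then b2n (c u v) else 0) + b2n (δ u v)) ∸ 1
                                                     ≤⟨ ∸-monoˡ-≤ 1 (sumℕ-mono cell) ⟩
  size P ∸ 1                                         ∎
  where
  open ≤-Reasoning
  cell : ∀ v → (if P v then b2n (c u v) else 0) + b2n (δ u v) ≤ b2n (P v)
  cell v with δ u v in e
  ... | true with refl ← δ-true {ℓ = u} {v} e rewrite u∈P | c-irr v = ≤-refl
  ... | false with P v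
  ...   | true  = ≤-trans (≤-reflexive (+-identityʳ _)) (b2n≤1 (c u v))
  ...   | false = z≤n

-- Fractional factors of graphs

module Halves where
  import Data.Nat as ℕ
  open import Data.Integer as ℤ using (ℤ; +_)
  open import Data.Rational using (toℚᵘ)
  import Data.Integer.Properties as ℤP
  import Data.Integer.Tactic.RingSolver as ℤ-Solver
  import Data.Rational.Properties as ℚP
  open import Data.Rational.Unnormalised as ℚᵘ using (mkℚᵘ; *≡*)
  import Data.Rational.Unnormalised.Properties as ℚᵘP

  half : ℕ → ℚ
  half x = (+ x) / 2

  half-+ : ∀ x y → half x ℚ.+ half y ≡ half (x ℕ.+ y)
  half-+ x y = ℚP.toℚᵘ-injective (begin
    toℚᵘ (half x ℚ.+ half y)          ≈⟨ ℚP.toℚᵘ-homo-+ (half x) (half y) ⟩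
    toℚᵘ (half x) ℚᵘ.+ toℚᵘ (half y)  ≈⟨ ℚᵘP.+-cong (ℚP.toℚᵘ-fromℚᵘ (mkℚᵘ (+ x) 1)) (ℚP.toℚᵘ-fromℚᵘ (mkℚᵘ (+ y) 1)) ⟩
    mkℚᵘ (+ x) 1 ℚᵘ.+ mkℚᵘ (+ y) 1    ≈⟨ *≡* (trans (cross (+ x) (+ y)) (cong (ℤ._* + 4) (sym (ℤP.pos-+ x y)))) ⟩
    mkℚᵘ (+ (x ℕ.+ y)) 1                ≈⟨ ℚP.toℚᵘ-fromℚᵘ (mkℚᵘ (+ (x ℕ.+ y)) 1) ⟨
    toℚᵘ (half (x ℕ.+ y))               ∎)
    where
    open ℚᵘP.≃-Reasoning
    cross : ∀ (p q : ℤ) → (p ℤ.* + 2 ℤ.+ q ℤ.* + 2) ℤ.* + 2 ≡ (p ℤ.+ q) ℤ.* + 4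
    cross = ℤ-Solver.solve-∀

  sumℚ-half : ∀ {N} (f : Fin N → ℕ) → sumℚ (λ v → half (f v)) ≡ half (sumℕ f)
  sumℚ-half {zero}  f = refl
  sumℚ-half {suc N} f =
    trans (cong (half (f zero) ℚ.+_) (sumℚ-half (f ∘ suc))) (half-+ (f zero) (sumℕ (f ∘ suc)))

  half-double : ∀ k → half (2 * k) ≡ (+ k) / 1
  half-double k = ℚP.toℚᵘ-injective (begin
    toℚᵘ (half (2 * k))  ≈⟨ ℚP.toℚᵘ-fromℚᵘ (mkℚᵘ (+ (2 * k)) 1) ⟩
    mkℚᵘ (+ (2 * k)) 1   ≈⟨ *≡* (trans (cong (ℤ._* + 1) (ℤP.pos-* 2 k)) (cross (+ k))) ⟩
    mkℚᵘ (+ k) 0         ≈⟨ ℚP.toℚᵘ-fromℚᵘ (mkℚᵘ (+ k) 0) ⟨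
    toℚᵘ ((+ k) / 1)     ∎)
    where
    open ℚᵘP.≃-Reasoning
    cross : ∀ (p : ℤ) → (+ 2 ℤ.* p) ℤ.* + 1 ≡ p ℤ.* + 2
    cross = ℤ-Solver.solve-∀

  half-nonNeg : ∀ x → 0ℚ ℚ.≤ half x
  half-nonNeg x = ℚP.nonNegative⁻¹ (half x) {{ℚP.normalize-nonNeg x 2}}

  half≤1 : ∀ {x} → x ≤ 2 → half x ℚ.≤ 1ℚ
  half≤1 {0} _ = ℚ.*≤* (ℤ.+≤+ z≤n)
  half≤1 {1} _ = ℚ.*≤* (ℤ.+≤+ (s≤s z≤n))
  half≤1 {2} _ = ℚP.≤-refl
  half≤1 {suc (suc (suc _))} (s≤s (s≤s ()))

open Halves

module _ {n} (G : Graph n) (H : EdgeSubset G) where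

  degreeH : Fin n → ℕ
  degreeH = rowSum (mem H)

  outsideH : Matrix n n
  outsideH u v = adj G u v ∧ not (mem H u v)

  outsideH-sym : Symmetric outsideH
  outsideH-sym u v = cong₂ (λ x y → x ∧ not y) (Graph.sym G u v) (msym H u v)

  outsideH-H : ∀ {u v} → mem H u v ≡ true → outsideH u v ≡ false
  outsideH-H {u} {v} uv∈H rewrite uv∈H = ∧-zeroʳ (adj G u v)

  adj-split : ∀ u v → b2n (adj G u v) ≡ b2n (outsideH u v) + b2n (mem H u v)
  adj-split u v with mem H u v in e
  ... | true rewrite sub H u v e = refl
  ... | false with adj G u v
  ...   | true  = refl
  ...   | false = refl

  CoveringFactor : ℕ → Set
  CoveringFactor k = Σ (FractionalKFactor G k) (λ F → ∀ u v → mem H u v ≡ true → h F u v ≡ 1ℚ)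

  transport⇒coveringFactor : ∀ {k} (a : Fin n → ℕ) → (∀ u → a u + degreeH u ≡ k) →
    Transport outsideH a a → CoveringFactor k
  transport⇒coveringFactor {k} a a+d≡k t = factor , λ u v uv∈H → cong half (g-H uv∈H)
    where
    open Transport t renaming (flow to x)
    -- Twice the factor: 2 on the edges of H, plus 1 for each orientation of uv used by the transport.
    g : Fin n → Fin n → ℕ
    g u v = 2 * b2n (mem H u v) + b2n (x u v) + b2n (x v u)
    x-off : ∀ {u v} → outsideH u v ≡ false → x u v ≡ false
    x-off {u} {v} e with x u v in xuv
    ... | false = refl
    ... | true with () ← trans (sym e) (flow⊆c u v xuv)
    g-H : ∀ {u v} → mem H u v ≡ true → g u v ≡ 2
    g-H {u} {v} uv∈H
      rewrite uv∈H | x-off (outsideH-H {u} {v} uv∈H) | x-off (outsideH-H {v} {u} (trans (msym H v u) uv∈H)) = refl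
    g≤2 : ∀ u v → g u v ≤ 2
    g≤2 u v = bound (mem H u v) refl
      where
      bound : ∀ b → mem H u v ≡ b → g u v ≤ 2
      bound true  e = ≤-reflexive (g-H e)
      bound false e rewrite e = +-mono-≤ (b2n≤1 (x u v)) (b2n≤1 (x v u))
    g-off : ∀ u v → adj G u v ≡ false → g u v ≡ 0
    g-off u v e with mem H u v in uv∈H
    ... | true with () ← trans (sym e) (sub H u v uv∈H)
    ... | false rewrite x-off {u} {v} (cong (_∧ not (mem H u v)) e)
                      | x-off {v} {u} (cong (_∧ not (mem H v u)) (trans (Graph.sym G v u) e)) = refl
    g-sym : ∀ u v → g u v ≡ g v u
    g-sym u v rewrite msym H u v = swap (2 * b2n (mem H v u)) (b2n (x u v)) (b2n (x v u))
      where
      swap : ∀ p q r → p + q + r ≡ p + r + q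
      swap = solve-∀
    g-row : ∀ u → sumℕ (g u) ≡ 2 * k
    g-row u = begin
      sumℕ (g u)
        ≡⟨ sumℕ-+ (λ v → 2 * b2n (mem H u v) + b2n (x u v)) (λ v → b2n (x v u)) ⟩
      sumℕ (λ v → 2 * b2n (mem H u v) + b2n (x u v)) + colSum x u
        ≡⟨ cong (_+ colSum x u) (sumℕ-+ (λ v → 2 * b2n (mem H u v)) (λ v → b2n (x u v))) ⟩
      sumℕ (λ v → 2 * b2n (mem H u v)) + rowSum x u + colSum x u
        ≡⟨ cong₂ (λ y z → y + z + colSum x u) (sumℕ-*ˡ 2 (λ v → b2n (mem H u v))) (rowSums u) ⟩
      2 * degreeH u + a u + colSum x u
        ≡⟨ cong (λ z → 2 * degreeH u + a u + z) (colSums u) ⟩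
      2 * degreeH u + a u + a u
        ≡⟨ regroup (degreeH u) (a u) ⟩
      2 * (a u + degreeH u)
        ≡⟨ cong (2 *_) (a+d≡k u) ⟩
      2 * k ∎
      where
      open ≡-Reasoning
      regroup : ∀ d w → 2 * d + w + w ≡ 2 * (w + d)
      regroup = solve-∀
    factor : FractionalKFactor G k
    factor = record
      { h     = λ u v → half (g u v)
      ; hsym  = λ u v → cong half (g-sym u v)
      ; hoff  = λ u v e → cong half (g-off u v e)
      ; hlow  = λ u v → half-nonNeg (g u v)
      ; hhigh = λ u v → half≤1 (g≤2 u v)
      ; hdeg  = λ u → trans (sumℚ-half (g u)) (trans (cong half (g-row u)) (half-double k))
      }

  record Obstruction (k : ℕ) : Set where
    field
      S T       : Fin n → Bool
      S∩T≡∅     : ∀ i → S i ≡ true → T i ≡ false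
      deficient : k * size S + edgesBetween (adj G) T (∁ S) < k * size T + sumOn S degreeH

  deficientPair⇒obstruction : ∀ {k} (a : Fin n → ℕ) → (∀ u → a u + degreeH u ≡ k) →
    DeficientPair outsideH a → Obstruction k
  deficientPair⇒obstruction {k} a a+d≡k p = record { S = S ; T = T ; S∩T≡∅ = S∩T≡∅ ; deficient = bound }
    where
    open DeficientPair p
    k-split : ∀ P → k * size P ≡ sumOn P a + sumOn P degreeH
    k-split P = trans (sym (sumOn-const P k)) (trans (sumℕ-cong (λ i → cong (if P i then_else 0) (sym (a+d≡k i))))
                                                     (sumOn-+ P a degreeH))
    ρ eᴿ eᴴ : ℕ
    ρ  = sumOn S degreeH
    eᴿ = edgesBetween outsideH T (∁ S)
    eᴴ = edgesBetween (mem H) T (∁ S)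
    bound : k * size S + edgesBetween (adj G) T (∁ S) < k * size T + ρ
    bound = begin-strict
      k * size S + edgesBetween (adj G) T (∁ S)
        ≡⟨ cong₂ _+_ (k-split S) (edgesBetween-+ adj-split T (∁ S)) ⟩
      (sumOn S a + ρ) + (eᴿ + eᴴ)
        ≡⟨ regroup (sumOn S a) ρ eᴿ eᴴ ⟩
      (eᴿ + sumOn S a) + (ρ + eᴴ)
        <⟨ +-monoˡ-< (ρ + eᴴ) deficient ⟩
      sumOn T a + (ρ + eᴴ)
        ≤⟨ +-monoʳ-≤ (sumOn T a) (+-monoʳ-≤ ρ (edgesBetween≤sumOn-rowSum (mem H) T (∁ S))) ⟩
      sumOn T a + (ρ + sumOn T degreeH)
        ≡⟨ regroup₂ (sumOn T a) ρ (sumOn T degreeH) ⟩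
      (sumOn T a + sumOn T degreeH) + ρ
        ≡⟨ cong (_+ ρ) (k-split T) ⟨
      k * size T + ρ ∎
      where
      open ≤-Reasoning
      regroup : ∀ x r e f → (x + r) + (e + f) ≡ (e + x) + (r + f)
      regroup = solve-∀
      regroup₂ : ∀ x r d → x + (r + d) ≡ (x + d) + r
      regroup₂ = solve-∀

  coveringFactor-or-obstruction : ∀ k → (∀ u → degreeH u ≤ k) → CoveringFactor k ⊎ Obstruction k
  coveringFactor-or-obstruction k d≤k =
    Sum.map (transport⇒coveringFactor a a+d≡k) (deficientPair⇒obstruction a a+d≡k)
                 (symmetricTransport-or-deficientPair outsideH-sym a)
    where
    a : Fin n → ℕ
    a u = k ∸ degreeH u
    a+d≡k : ∀ u → a u + degreeH u ≡ k
    a+d≡k u = m∸n+n≡m (d≤k u)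

  mem-irreflexive : Irreflexive (mem H)
  mem-irreflexive u with mem H u u in e
  ... | false = refl
  ... | true with () ← trans (sym (sub H u u e)) (irrefl G u)

  degreeH≤∣H∣ : ∀ u → degreeH u ≤ pairCount (mem H)
  degreeH≤∣H∣ = rowSum≤pairCount (msym H) mem-irreflexive

  sumOn-degreeH≤2∣H∣ : ∀ S → sumOn S degreeH ≤ 2 * pairCount (mem H)
  sumOn-degreeH≤2∣H∣ S = ≤-trans (sumOn≤sumℕ S degreeH) (≤-reflexive (handshake (msym H) mem-irreflexive))

module _ {n} (G : Graph n) where

  degree-split : ∀ P u → degree G u ≡ sumOn P (λ v → b2n (adj G u v)) + sumOn (∁ P) (λ v → b2n (adj G u v))
  degree-split P u = sumOn-split (λ _ → true) P (λ v → b2n (adj G u v))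

  sumOn-degree≤ : ∀ S T → sumOn T (degree G) ≤ size S * size T + edgesBetween (adj G) T (∁ S)
  sumOn-degree≤ S T = begin
    sumOn T (degree G)
      ≤⟨ sumOn-mono T (λ u → ≤-trans (≤-reflexive (degree-split S u)) (+-monoˡ-≤ _ (sumOn-b2n≤size S (adj G u)))) ⟩
    sumOn T (λ u → size S + sumOn (∁ S) (λ v → b2n (adj G u v)))
      ≡⟨ sumOn-+ T (λ _ → size S) (λ u → sumOn (∁ S) (λ v → b2n (adj G u v))) ⟩
    sumOn T (λ _ → size S) + edgesBetween (adj G) T (∁ S)
      ≡⟨ cong (_+ edgesBetween (adj G) T (∁ S)) (sumOn-const T (size S)) ⟩
    size S * size T + edgesBetween (adj G) T (∁ S) ∎
    where open ≤-Reasoning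

  edgeCount≤ : ∀ T → 2 * edgeCount G ≤ 2 * sumOn T (degree G) + size (∁ T) * (size (∁ T) ∸ 1)
  edgeCount≤ T = begin
    2 * edgeCount G
      ≡⟨ handshake (Graph.sym G) (irrefl G) ⟨
    sumℕ (degree G)
      ≡⟨ sumOn-split (λ _ → true) T (degree G) ⟩
    sumOn T (degree G) + sumOn (∁ T) (degree G)
      ≡⟨ cong (sumOn T (degree G) +_) (trans (sumℕ-cong (λ u → cong (if not (T u) then_else 0) (degree-split T u)))
                                             (sumOn-+ (∁ T) _ _)) ⟩
    sumOn T (degree G) + (edgesBetween (adj G) (∁ T) T + edgesBetween (adj G) (∁ T) (∁ T))
      ≤⟨ +-monoʳ-≤ (sumOn T (degree G)) (+-mono-≤ toT withinT) ⟩
    sumOn T (degree G) + (sumOn T (degree G) + sumOn (∁ T) (λ _ → p ∸ 1))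
      ≡⟨ cong (λ z → sumOn T (degree G) + (sumOn T (degree G) + z)) (sumOn-const (∁ T) (p ∸ 1)) ⟩
    sumOn T (degree G) + (sumOn T (degree G) + (p ∸ 1) * p)
      ≡⟨ regroup (sumOn T (degree G)) p (p ∸ 1) ⟩
    2 * sumOn T (degree G) + p * (p ∸ 1) ∎
    where
    open ≤-Reasoning
    p : ℕ
    p = size (∁ T)
    toT : edgesBetween (adj G) (∁ T) T ≤ sumOn T (degree G)
    toT = ≤-trans (≤-reflexive (edgesBetween-comm (Graph.sym G) (∁ T) T)) (edgesBetween≤sumOn-rowSum (adj G) T (∁ T))
    withinT : edgesBetween (adj G) (∁ T) (∁ T) ≤ sumOn (∁ T) (λ _ → p ∸ 1)
    withinT = sumℕ-mono (λ u → cell u (T u) refl)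
      where
      cell : ∀ u t → T u ≡ t → (if not (T u) then sumOn (∁ T) (λ v → b2n (adj G u v)) else 0)
                                ≤ (if not (T u) then p ∸ 1 else 0)
      cell u true  e rewrite e = z≤n
      cell u false e rewrite e = sumOn-row≤size∸1 (irrefl G) (∁ T) u (cong not e)
    regroup : ∀ d p q → d + (d + q * p) ≡ 2 * d + p * q
    regroup = solve-∀

-- Arithmetic of the edge bound

2*C2+n≡n*n : ∀ n → 2 * (n C 2) + n ≡ n * n
2*C2+n≡n*n zero    = refl
2*C2+n≡n*n (suc n) = begin
  2 * (suc n C 2) + suc n        ≡⟨ cong (λ z → 2 * z + suc n) (nCk+nC[k+1]≡[n+1]C[k+1] n 1) ⟨
  2 * (n C 1 + n C 2) + suc n    ≡⟨ cong (λ z → 2 * (z + n C 2) + suc n) (nC1≡n n) ⟩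
  2 * (n + n C 2) + suc n        ≡⟨ regroup n (n C 2) ⟩
  (2 * (n C 2) + n) + (2 * n + 1) ≡⟨ cong (_+ (2 * n + 1)) (2*C2+n≡n*n n) ⟩
  n * n + (2 * n + 1)            ≡⟨ square n ⟩
  suc n * suc n                  ∎
  where
  open ≡-Reasoning
  regroup : ∀ n c → 2 * (n + c) + suc n ≡ (2 * c + n) + (2 * n + 1)
  regroup = solve-∀
  square : ∀ n → n * n + (2 * n + 1) ≡ suc n * suc n
  square = solve-∀

n*[n∸1]+n≡n*n : ∀ n → n * (n ∸ 1) + n ≡ n * n
n*[n∸1]+n≡n*n zero    = refl
n*[n∸1]+n≡n*n (suc n) = lemma n
  where
  lemma : ∀ n → suc n * n + suc n ≡ suc n * suc n
  lemma = solve-∀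

slack : ∀ {x y} c → x ≤ y → x ≡ y + suc c → ⊥
slack {y = y} c x≤y x≡ = m+1+n≰m y (subst (_≤ y) x≡ x≤y)

4m≤2km : ∀ {k} m → 2 ≤ k → 4 * m ≤ 2 * k * m
4m≤2km m 2≤k = *-monoˡ-≤ m (*-monoʳ-≤ 2 2≤k)

balance : ∀ {k m s t D ρ Δ} → k * s + D < k * t + ρ → (k + m) * t ≤ Δ → Δ ≤ s * t + D →
          k * s + 1 + m * t ≤ ρ + s * t
balance {k} {m} {s} {t} {D} {ρ} deficient Δ≥ Δ≤ =
  +-cancelʳ-≤ (k * t + D) _ _ (subst₂ _≤_ (lhs k m s t D) (rhs k s t D ρ) (+-mono-≤ deficient (≤-trans Δ≥ Δ≤)))
  where
  lhs : ∀ k m s t D → suc (k * s + D) + (k + m) * t ≡ k * s + 1 + m * t + (k * t + D)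
  lhs = solve-∀
  rhs : ∀ k s t D ρ → k * t + ρ + (s * t + D) ≡ ρ + s * t + (k * t + D)
  rhs = solve-∀

balance⇒m<s : ∀ {k m s t ρ} → m ≤ k → k * s + 1 + m * t ≤ ρ + s * t → ρ ≤ m * s → m < s
balance⇒m<s {k} {m} {s} {t} {ρ} m≤k bal ρ≤ms with m <? s
... | yes m<s = m<s
... | no m≮s = ⊥-elim (m+1+n≰m (k * s) (begin
      k * s + 1   ≤⟨ +-cancelʳ-≤ (m * t) _ _ (≤-trans bal (+-monoʳ-≤ ρ (*-monoˡ-≤ t (≮⇒≥ m≮s)))) ⟩
      ρ           ≤⟨ ρ≤ms ⟩
      m * s       ≤⟨ *-monoˡ-≤ s m≤k ⟩
      k * s       ∎))
  where open ≤-Reasoning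

balance⇒k<t : ∀ {k m s t} → 2 ≤ k → m ≤ s → k * s + 1 + m * t ≤ 2 * m + s * t → k < t
balance⇒k<t {k} {m} {s} {t} 2≤k m≤s bal with k <? t
... | yes k<t = k<t
... | no k≮t with r , refl ← m≤n⇒∃[o]m+o≡n (≮⇒≥ k≮t) = ⊥-elim (m+1+n≰m (2 * m) (begin
      2 * m + 1            ≤⟨ +-monoˡ-≤ 1 (*-monoˡ-≤ m 2≤k) ⟩
      (t + r) * m + 1      ≡⟨ split t r m ⟩
      r * m + 1 + m * t    ≤⟨ +-monoˡ-≤ (m * t) (+-monoˡ-≤ 1 (*-monoʳ-≤ r m≤s)) ⟩
      r * s + 1 + m * t    ≤⟨ +-cancelʳ-≤ (s * t) _ _ (subst (_≤ 2 * m + s * t) (split₂ t r s m) bal) ⟩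
      2 * m                ∎))
  where
  open ≤-Reasoning
  split : ∀ t r m → (t + r) * m + 1 ≡ r * m + 1 + m * t
  split = solve-∀
  split₂ : ∀ t r s m → (t + r) * s + 1 + m * t ≡ r * s + 1 + m * t + s * t
  split₂ = solve-∀

s<t+m : ∀ {k m s t D ρ} → 2 ≤ k → k * s + D < k * t + ρ → ρ ≤ 2 * m → s < t + m
s<t+m {k} {m} {s} {t} {D} {ρ} 2≤k deficient ρ≤2m = *-cancelˡ-< k s (t + m) (begin-strict
  k * s          ≤⟨ m≤m+n (k * s) D ⟩
  k * s + D      <⟨ deficient ⟩
  k * t + ρ      ≤⟨ +-monoʳ-≤ (k * t) (≤-trans ρ≤2m (*-monoˡ-≤ m 2≤k)) ⟩
  k * t + k * m  ≡⟨ *-distribˡ-+ k t m ⟨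
  k * (t + m)    ∎)
  where open ≤-Reasoning

edgeCount-inequality : ∀ {k m s j p D E} →
  k * s + D < k * suc (k + j) + 2 * m →
  2 * E ≤ 2 * (s * suc (k + j) + D) + p * (p ∸ 1) →
  ((p + j) C 2) + k * k + 2 * k + (k + 1) * m ≤ E →
  2 * p * j + j * j + 2 * k + 2 * k * m + 2 ≤ 2 * s + 2 * j * s + 2 * k * j + 2 * m + j
edgeCount-inequality {k} {m} {s} {j} {p} {D} {E} deficient 2E≤ E≥ = +-cancelʳ-≤ W _ _ (begin
  2 * p * j + j * j + 2 * k + 2 * k * m + 2 + W
    ≡⟨ L₂ k m s D p j ⟨
  (p + j) * (p + j) + X
    ≡⟨ cong (_+ X) (2*C2+n≡n*n (p + j)) ⟨
  2 * c + (p + j) + X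
    ≡⟨ L₁ c k m s D p j ⟨
  2 * (c + k * k + 2 * k + (k + 1) * m) + 2 * (k * s + D + 1) + (p + j + p)
    ≤⟨ +-monoˡ-≤ (p + j + p) (+-mono-≤ (≤-trans (*-monoʳ-≤ 2 E≥) 2E≤)
                                       (*-monoʳ-≤ 2 (subst (_≤ k * suc (k + j) + 2 * m) (+-comm 1 (k * s + D)) deficient))) ⟩
  2 * (s * suc (k + j) + D) + p * (p ∸ 1) + 2 * (k * suc (k + j) + 2 * m) + (p + j + p)
    ≡⟨ R₁ (p * (p ∸ 1)) k m s D p j ⟩
  p * (p ∸ 1) + p + Y
    ≡⟨ cong (_+ Y) (n*[n∸1]+n≡n*n p) ⟩
  p * p + Y
    ≡⟨ R₂ k m s D p j ⟩
  2 * s + 2 * j * s + 2 * k * j + 2 * m + j + W ∎)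
  where
  open ≤-Reasoning
  c X Y W : ℕ
  c = (p + j) C 2
  X = 2 * (k * k) + 4 * k + 2 * ((k + 1) * m) + 2 * (k * s) + 2 * D + 2 + p
  Y = 2 * (s * suc (k + j) + D) + 2 * (k * suc (k + j) + 2 * m) + (p + j)
  W = p * p + p + 2 * (k * k) + 2 * k + 2 * m + 2 * (k * s) + 2 * D
  L₁ : ∀ c k m s D p j → 2 * (c + k * k + 2 * k + (k + 1) * m) + 2 * (k * s + D + 1) + (p + j + p)
                         ≡ 2 * c + (p + j) + (2 * (k * k) + 4 * k + 2 * ((k + 1) * m) + 2 * (k * s) + 2 * D + 2 + p)
  L₁ = solve-∀
  L₂ : ∀ k m s D p j → (p + j) * (p + j) + (2 * (k * k) + 4 * k + 2 * ((k + 1) * m) + 2 * (k * s) + 2 * D + 2 + p)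
                       ≡ 2 * p * j + j * j + 2 * k + 2 * k * m + 2 + (p * p + p + 2 * (k * k) + 2 * k + 2 * m + 2 * (k * s) + 2 * D)
  L₂ = solve-∀
  R₁ : ∀ q k m s D p j → 2 * (s * suc (k + j) + D) + q + 2 * (k * suc (k + j) + 2 * m) + (p + j + p)
                         ≡ q + p + (2 * (s * suc (k + j) + D) + 2 * (k * suc (k + j) + 2 * m) + (p + j))
  R₁ = solve-∀
  R₂ : ∀ k m s D p j → p * p + (2 * (s * suc (k + j) + D) + 2 * (k * suc (k + j) + 2 * m) + (p + j))
                       ≡ 2 * s + 2 * j * s + 2 * k * j + 2 * m + j + (p * p + p + 2 * (k * k) + 2 * k + 2 * m + 2 * (k * s) + 2 * D)
  R₂ = solve-∀

j≤2k+2 : ∀ {k m s j p} → 2 ≤ k → s ≤ p → s ≤ k + j + m →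
  2 * p * j + j * j + 2 * k + 2 * k * m + 2 ≤ 2 * s + 2 * j * s + 2 * k * j + 2 * m + j → j ≤ 2 * k + 2
j≤2k+2 {k} {m} {s} {j} {p} 2≤k s≤p s≤k+j+m edges with j ≤? 2 * k + 2
... | yes j≤ = j≤
... | no j≰ = ⊥-elim (slack 1 (+-mono-≤ edges bounds) (excess k m s j p))
  where
  bounds : 2 * s + 2 * j * s + 4 * m + suc (2 * k + 2) * j ≤ 2 * (k + j + m) + 2 * j * p + 2 * k * m + j * j
  bounds = +-mono-≤ (+-mono-≤ (+-mono-≤ (*-monoʳ-≤ 2 s≤k+j+m) (*-monoʳ-≤ (2 * j) s≤p)) (4m≤2km m 2≤k))
                    (*-monoˡ-≤ j (≰⇒> j≰))
  excess : ∀ k m s j p →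
    2 * p * j + j * j + 2 * k + 2 * k * m + 2 + (2 * s + 2 * j * s + 4 * m + suc (2 * k + 2) * j)
    ≡ 2 * s + 2 * j * s + 2 * k * j + 2 * m + j + (2 * (k + j + m) + 2 * j * p + 2 * k * m + j * j) + 2
  excess = solve-∀

edgeCount-inequality-impossible : ∀ {k m s j p} → 2 ≤ k → 13 * k + 8 * m + 14 ≤ 2 * (p + suc (k + j)) →
  s ≤ k + j + m → j ≤ 2 * k + 2 →
  2 * p * j + j * j + 2 * k + 2 * k * m + 2 ≤ 2 * s + 2 * j * s + 2 * k * j + 2 * m + j → ⊥
edgeCount-inequality-impossible {k} {m} {s} {j} {p} 2≤k n-large s≤k+j+m j≤2k+2 edges =
  slack (1 + k * j + 6 * m * j + 3 * j) (+-mono-≤ edges bounds) (excess k m s j p)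
  where
  bounds : (13 * k + 8 * m + 14) * j + 3 * (j * j) + 4 * m + 2 * (1 + j) * s
           ≤ 2 * (p + suc (k + j)) * j + 3 * ((2 * k + 2) * j) + 2 * k * m + 2 * (1 + j) * (k + j + m)
  bounds = +-mono-≤ (+-mono-≤ (+-mono-≤ (*-monoˡ-≤ j n-large) (*-monoʳ-≤ 3 (*-monoˡ-≤ j j≤2k+2))) (4m≤2km m 2≤k))
                    (*-monoʳ-≤ (2 * (1 + j)) s≤k+j+m)
  excess : ∀ k m s j p →
    2 * p * j + j * j + 2 * k + 2 * k * m + 2 + ((13 * k + 8 * m + 14) * j + 3 * (j * j) + 4 * m + 2 * (1 + j) * s)
    ≡ 2 * s + 2 * j * s + 2 * k * j + 2 * m + j
      + (2 * (p + suc (k + j)) * j + 3 * ((2 * k + 2) * j) + 2 * k * m + 2 * (1 + j) * (k + j + m))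
      + suc (1 + k * j + 6 * m * j + 3 * j)
  excess = solve-∀

obstruction⇒k<t : ∀ {k m s t D ρ Δ} → 2 ≤ k → m ≤ k → k * s + D < k * t + ρ → ρ ≤ m * s → ρ ≤ 2 * m →
  (k + m) * t ≤ Δ → Δ ≤ s * t + D → k < t
obstruction⇒k<t {k} {m} {s} {t} {D} {ρ} {Δ} 2≤k m≤k deficient ρ≤ms ρ≤2m Δ≥ Δ≤ =
  balance⇒k<t {k} {m} {s} {t} 2≤k (<⇒≤ (balance⇒m<s {k} {m} {s} {t} {ρ} m≤k bal ρ≤ms)) (≤-trans bal (+-monoˡ-≤ (s * t) ρ≤2m))
  where
  bal : k * s + 1 + m * t ≤ ρ + s * t
  bal = balance {k} {m} {s} {t} {D} {ρ} {Δ} deficient Δ≥ Δ≤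

obstruction-arithmetic : ∀ {k m s t p D ρ Δ E} → 2 ≤ k → m ≤ k →
  13 * k + 8 * m + 14 ≤ 2 * (p + t) → s ≤ p →
  k * s + D < k * t + ρ → ρ ≤ m * s → ρ ≤ 2 * m →
  (k + m) * t ≤ Δ → Δ ≤ s * t + D → 2 * E ≤ 2 * Δ + p * (p ∸ 1) →
  ((p + t ∸ k ∸ 1) C 2) + k * k + 2 * k + (k + 1) * m ≤ E → ⊥
obstruction-arithmetic {k} {m} {s} {t} {p} {D} {ρ} {Δ} {E} 2≤k m≤k n-large s≤p deficient ρ≤ms ρ≤2m Δ≥ Δ≤ 2E≤ E≥
  with j , refl ← m≤n⇒∃[o]m+o≡n (obstruction⇒k<t {k} {m} {s} {t} {D} {ρ} {Δ} 2≤k m≤k deficient ρ≤ms ρ≤2m Δ≥ Δ≤)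
  = edgeCount-inequality-impossible {k} {m} {s} {j} {p} 2≤k n-large s≤k+j+m (j≤2k+2 {k} {m} {s} {j} {p} 2≤k s≤p s≤k+j+m edges) edges
  where
  s≤k+j+m : s ≤ k + j + m
  s≤k+j+m = ≤-pred (s<t+m 2≤k deficient ρ≤2m)
  edges : 2 * p * j + j * j + 2 * k + 2 * k * m + 2 ≤ 2 * s + 2 * j * s + 2 * k * j + 2 * m + j
  edges = edgeCount-inequality {k} {m} {s} {j} {p} {D} {E} (≤-trans deficient (+-monoʳ-≤ _ ρ≤2m)) (≤-trans 2E≤ (+-monoˡ-≤ _ (*-monoʳ-≤ 2 Δ≤)))
            (subst (λ x → (x C 2) + k * k + 2 * k + (k + 1) * m ≤ E) (n∸k∸1 p k j) E≥)
    where
    n∸k∸1 : ∀ p k j → p + suc (k + j) ∸ k ∸ 1 ≡ p + j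
    n∸k∸1 p k j = trans (cong (λ x → x ∸ k ∸ 1) (reorder p k j))
                        (trans (cong (_∸ 1) (m+n∸n≡m (p + j + 1) k)) (m+n∸n≡m (p + j) 1))
      where
      reorder : ∀ p k j → p + suc (k + j) ≡ p + j + 1 + k
      reorder = solve-∀

theorem1p5 : (k m n : ℕ) → 2 ≤ k → 1 ≤ m → m ≤ k →
  (G : Graph n) → Connected G →
  13 * k + 8 * m + 14 ≤ 2 * n →
  minDegree≥ G (k + m) →
  ((n ∸ k ∸ 1) C 2) + k * k + 2 * k + (k + 1) * m ≤ edgeCount G →
  FractionalCovered G k m
theorem1p5 k m n 2≤k _ m≤k G _ n-large δ≥k+m e-large H ∣H∣≡m =
  [ id , ⊥-elim ∘ impossible ]′ (coveringFactor-or-obstruction G H k (λ u → ≤-trans (degreeH≤m u) m≤k))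
  where
  degreeH≤m : ∀ u → degreeH G H u ≤ m
  degreeH≤m u = subst (degreeH G H u ≤_) ∣H∣≡m (degreeH≤∣H∣ G H u)
  impossible : Obstruction G H k → ⊥
  impossible o = obstruction-arithmetic 2≤k m≤k n-large′ ∣S∣≤∣∁T∣ deficient ρ≤m∣S∣ ρ≤2m
                   (degree-sum≥ T) (sumOn-degree≤ G S T) (edgeCount≤ G T) e-large′
    where
    open Obstruction o
    n≡ : n ≡ size (∁ T) + size T
    n≡ = sym (size-∁+size T)
    n-large′ : 13 * k + 8 * m + 14 ≤ 2 * (size (∁ T) + size T)
    n-large′ = subst (λ x → 13 * k + 8 * m + 14 ≤ 2 * x) n≡ n-large
    e-large′ : ((size (∁ T) + size T ∸ k ∸ 1) C 2) + k * k + 2 * k + (k + 1) * m ≤ edgeCount G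
    e-large′ = subst (λ x → ((x ∸ k ∸ 1) C 2) + k * k + 2 * k + (k + 1) * m ≤ edgeCount G) n≡ e-large
    ∣S∣≤∣∁T∣ : size S ≤ size (∁ T)
    ∣S∣≤∣∁T∣ = size-mono (λ i i∈S → cong not (S∩T≡∅ i i∈S))
    ρ≤m∣S∣ : sumOn S (degreeH G H) ≤ m * size S
    ρ≤m∣S∣ = ≤-trans (sumOn-mono S degreeH≤m) (≤-reflexive (sumOn-const S m))
    ρ≤2m : sumOn S (degreeH G H) ≤ 2 * m
    ρ≤2m = subst (λ x → sumOn S (degreeH G H) ≤ 2 * x) ∣H∣≡m (sumOn-degreeH≤2∣H∣ G H S)
    degree-sum≥ : ∀ P → (k + m) * size P ≤ sumOn P (degree G)
    degree-sum≥ P = ≤-trans (≤-reflexive (sym (sumOn-const P (k + m)))) (sumOn-mono P δ≥k+m)
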